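{- Let $\mathbf{L}$ be a Euclidean modal logic such that $\mathtt{S}_{\mathbf{L}}\setminus\big((\{1\}\times\mathbf{N}^{ - })\cup(\mathbf{N}^{+}\times\{ -1,0,1\})\big)$ is finite. Let $\varphi$ be a modal formula such that $\mathbf{L}=\mathbf{K5}\oplus\varphi$. Let $k$ be the least integer such that $k\geq 4$ and for all $m\in\mathbf{N}^{+}$, $n\in\mathbf{N}^{ - }$, if $(m,n)\in\mathtt{S}_{\mathbf{L}}\setminus\big((\{1\}\times\mathbf{N}^{ - })\cup(\mathbf{N}^{+}\times\{ -1,0,1\})\big)$ then $m+n\leq k$. Then for every first-order sentence $A$ and every individual variable $\mathbf{x}$ not occurring in $A$, the following are equivalent: (1) $A$ is modally definable in $\mathtt{Fr}(\mathbf{L})$; (2) $A\leftrightarrow\forall\mathbf{x}\,\tau(\mathbf{x},A)$ belongs to $\mathtt{Th}(\mathtt{Fr}(\mathbf{L}))$, and for all $m,m'\in\mathbf{N}^{+}$ and all $n,n'\in\mathbf{N}^{ - }$, if $\mathcal{F}_m^n\models\varphi$, $(m,n)\in\Pi_k^A$, $m'\leq m$, $n'\leq n$ and $\mathcal{F}_m^n\models A$, then $\mathcal{F}_{m'}^{n'}\models A$.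
   Context: A frame is a pair $(W,R)$ with $W$ non-empty and $R\subseteq W\times W$. Modal formulas are built from propositional variables, $\bot$, $\neg$, $\vee$, $\Box$ with Kripke semantics; validity means truth at every point under every valuation. A (normal) modal logic is a set of modal formulas containing all tautologies and all instances of $\Box(\varphi\to\psi)\to(\Box\varphi\to\Box\psi)$, closed under uniform substitution, modus ponens and necessitation; consistent means not containing $\bot$. A Euclidean modal logic is a consistent modal logic containing $\Diamond\psi\to\Box\Diamond\psi$ for all $\psi$; $\mathbf{K5}\oplus\varphi$ is the least normal modal logic containing all $\Diamond\psi\to\Box\Diamond\psi$ and $\varphi$. $\mathtt{Fr}(\mathbf{L})$ is the class of frames validating $\mathbf{L}$. First-order formulas use equality and one binary relation symbol $\mathbf{R}$ (built from atoms with $\neg,\vee,\forall$); $\mathtt{Th}(\mathcal{C})$ is the set of sentences valid in all frames of $\mathcal{C}$. A sentence $A$ is modally definable in $\mathcal{C}$ if some modal formula $\psi$ satisfies $\mathcal{F}\models\psi\iff\mathcal{F}\models A$ for all $\mathcal{F}\in\mathcal{C}$. The rooted translation $\tau(\mathbf{x},A)$ (for $\mathbf{x}$ not in $A$) is defined by: $\tau(\mathbf{x},\mathbf{R}(\mathbf{y},\mathbf{z}))=\mathbf{R}(\mathbf{y},\mathbf{z})$, $\tau(\mathbf{x},\mathbf{y}=\mathbf{z})=(\mathbf{y}=\mathbf{z})$, $\tau(\mathbf{x},\neg B)=\neg\tau(\mathbf{x},B)$, $\tau(\mathbf{x},B\vee C)=\tau(\mathbf{x},B)\vee\tau(\mathbf{x},C)$,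 $\tau(\mathbf{x},\forall\mathbf{y}B)=\forall\mathbf{y}\big(\mathbf{x}=\mathbf{y}\vee\exists\mathbf{z}(\mathbf{R}(\mathbf{x},\mathbf{z})\wedge\mathbf{R}(\mathbf{z},\mathbf{y}))\rightarrow\tau(\mathbf{x},B)\big)$. $\mathtt{qd}(A)$ is the quantifier depth and $\mathtt{qdd}(A)=\max\{\mathtt{qd}(A),3\}$. $\mathbf{N}^{+}=\mathbb{N}\setminus\{0\}$, $\mathbf{N}^{ - }=\mathbb{N}\cup\{ -1\}$. For $k\geq 4$, $\Pi_k^A$ is the set of pairs $(m,n)$ with $m\in\mathbf{N}^{+}$, $n\in\mathbf{N}^{ - }$ such that: if $m\geq2$ and $n\geq2$ then $m+n\leq k$; if $m=1$ then $n\leq\mathtt{qdd}(A)$; and if $n\in\{ -1,0,1\}$ then $m\leq\mathtt{qdd}(A)$. For $m\in\mathbf{N}^{+}$, $n\in\mathbf{N}^{ - }$ the flower $\mathcal{F}_m^n$ is: if $n\in\mathbb{N}$, universe $\{0,\dots,m+n\}$ with relation $(\{0\}\times\{1,\dots,m\})\cup(\{1,\dots,m+n\}\times\{1,\dots,m+n\})$; if $n=-1$, universe $\{1,\dots,m\}$ with the universal relation. $\mathtt{S}_{\mathbf{L}}=\{(m,n)\in\mathbf{N}^{+}\times\mathbf{N}^{ - }:\mathcal{F}_m^n\text{ validates }\mathbf{L}\}$. -}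

module Defs where

open import Data.Nat using (ℕ; zero; suc; _+_; _≤_; z≤n; s≤s; _⊔_)
open import Data.Nat.Properties using (≤-refl)
open import Data.Integer as ℤ using (ℤ; +_; -[1+_])
open import Data.Bool using (Bool; true; false; not; _∨_)
open import Data.Product using (Σ; Σ-syntax; _×_; _,_)
open import Data.Sum using (_⊎_)
open import Data.Empty using (⊥)
open import Data.Unit using (⊤)
open import Data.List using (List)
open import Data.List.Membership.Propositional using (_∈_)
open import Relation.Nullary using (¬_)
open import Relation.Binary.PropositionalEquality using (_≡_)

-- Meta-level classical logic: we use the Gödel–Gentzen negative
-- translation (¬¬ in front of atoms, disjunctions and existentials).

¬¬_ : ∀ {a} → Set a → Set a
¬¬ A = ¬ ¬ A

record Frame : Set₁ where
  field
    W  : Set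
    R  : W → W → Set
    pt : W            -- W is non-empty
open Frame public

data MF : Set where
  var : ℕ → MF
  ⊥ₘ  : MF
  ¬ₘ_ : MF → MF
  _∨ₘ_ : MF → MF → MF
  □_  : MF → MF

_⇒ₘ_ : MF → MF → MF
a ⇒ₘ b = (¬ₘ a) ∨ₘ b

◇_ : MF → MF
◇ a = ¬ₘ (□ (¬ₘ a))

_[_]ₘ : MF → (ℕ → MF) → MF
var p [ σ ]ₘ = σ p
⊥ₘ [ σ ]ₘ = ⊥ₘ
(¬ₘ a) [ σ ]ₘ = ¬ₘ (a [ σ ]ₘ)
(a ∨ₘ b) [ σ ]ₘ = (a [ σ ]ₘ) ∨ₘ (b [ σ ]ₘ)
(□ a) [ σ ]ₘ = □ (a [ σ ]ₘ)

-- propositional tautologies: true under every Boolean assignment to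
-- the maximal non-Boolean subformulas (variables and boxed formulas)
evalB : (MF → Bool) → MF → Bool
evalB v (var p) = v (var p)
evalB v ⊥ₘ = false
evalB v (¬ₘ a) = not (evalB v a)
evalB v (a ∨ₘ b) = evalB v a ∨ evalB v b
evalB v (□ a) = v (□ a)

Taut : MF → Set
Taut a = (v : MF → Bool) → evalB v a ≡ true

⟦_⟧ₘ : MF → (F : Frame) → (ℕ → W F → Set) → W F → Set
⟦ var p ⟧ₘ F V w = ¬¬ (V p w)
⟦ ⊥ₘ ⟧ₘ F V w = ⊥
⟦ ¬ₘ a ⟧ₘ F V w = ¬ (⟦ a ⟧ₘ F V w)
⟦ a ∨ₘ b ⟧ₘ F V w = ¬¬ (⟦ a ⟧ₘ F V w ⊎ ⟦ b ⟧ₘ F V w)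
⟦ □ a ⟧ₘ F V w = (v : W F) → R F w v → ⟦ a ⟧ₘ F V v

_⊨ₘ_ : Frame → MF → Set₁
F ⊨ₘ a = (V : ℕ → W F → Set) (w : W F) → ⟦ a ⟧ₘ F V w

Logic : Set₁
Logic = MF → Set

record IsNormalLogic (L : Logic) : Set where
  field
    tauts : ∀ a → Taut a → L a
    axK   : ∀ a b → L ((□ (a ⇒ₘ b)) ⇒ₘ ((□ a) ⇒ₘ (□ b)))
    usub  : ∀ a (σ : ℕ → MF) → L a → L (a [ σ ]ₘ)
    mp    : ∀ a b → L (a ⇒ₘ b) → L a → L b
    nec   : ∀ a → L a → L (□ a)

record IsEuclideanLogic (L : Logic) : Set where
  field
    normal     : IsNormalLogic L
    consistent : ¬ L ⊥ₘ
    ax5        : ∀ a → L ((◇ a) ⇒ₘ (□ (◇ a)))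

data K5⊕ (φ : MF) : MF → Set where
  taut : ∀ a → Taut a → K5⊕ φ a
  axK  : ∀ a b → K5⊕ φ ((□ (a ⇒ₘ b)) ⇒ₘ ((□ a) ⇒ₘ (□ b)))
  ax5  : ∀ a → K5⊕ φ ((◇ a) ⇒ₘ (□ (◇ a)))
  axφ  : K5⊕ φ φ
  usub : ∀ a (σ : ℕ → MF) → K5⊕ φ a → K5⊕ φ (a [ σ ]ₘ)
  mp   : ∀ a b → K5⊕ φ (a ⇒ₘ b) → K5⊕ φ a → K5⊕ φ b
  nec  : ∀ a → K5⊕ φ a → K5⊕ φ (□ a)

SameLogic : Logic → Logic → Set
SameLogic L L' = ∀ a → (L a → L' a) × (L' a → L a)

Fr : Logic → Frame → Set₁
Fr L F = ∀ a → L a → F ⊨ₘ a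

data FO : Set where
  Rf   : ℕ → ℕ → FO
  _≐_  : ℕ → ℕ → FO
  ¬f_  : FO → FO
  _∨f_ : FO → FO → FO
  ∀f   : ℕ → FO → FO

_∧f_ : FO → FO → FO
A ∧f B = ¬f ((¬f A) ∨f (¬f B))

_⇒f_ : FO → FO → FO
A ⇒f B = (¬f A) ∨f B

_⇔f_ : FO → FO → FO
A ⇔f B = (A ⇒f B) ∧f (B ⇒f A)

∃f : ℕ → FO → FO
∃f x A = ¬f (∀f x (¬f A))

data FreeIn (x : ℕ) : FO → Set where
  rl  : ∀ {z} → FreeIn x (Rf x z)
  rr  : ∀ {y} → FreeIn x (Rf y x)
  el  : ∀ {z} → FreeIn x (x ≐ z)
  er  : ∀ {y} → FreeIn x (y ≐ x)
  ng  : ∀ {A} → FreeIn x A → FreeIn x (¬f A)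
  ol  : ∀ {A B} → FreeIn x A → FreeIn x (A ∨f B)
  or  : ∀ {A B} → FreeIn x B → FreeIn x (A ∨f B)
  al  : ∀ {y A} → ¬ (x ≡ y) → FreeIn x A → FreeIn x (∀f y A)

Sentence : FO → Set
Sentence A = ∀ x → ¬ FreeIn x A

data OccursIn (x : ℕ) : FO → Set where
  rl  : ∀ {z} → OccursIn x (Rf x z)
  rr  : ∀ {y} → OccursIn x (Rf y x)
  el  : ∀ {z} → OccursIn x (x ≐ z)
  er  : ∀ {y} → OccursIn x (y ≐ x)
  ng  : ∀ {A} → OccursIn x A → OccursIn x (¬f A)
  ol  : ∀ {A B} → OccursIn x A → OccursIn x (A ∨f B)
  or  : ∀ {A B} → OccursIn x B → OccursIn x (A ∨f B)
  ab  : ∀ {A} → OccursIn x (∀f x A)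
  al  : ∀ {y A} → OccursIn x A → OccursIn x (∀f y A)

qd : FO → ℕ
qd (Rf _ _) = 0
qd (_ ≐ _) = 0
qd (¬f A) = qd A
qd (A ∨f B) = qd A ⊔ qd B
qd (∀f _ A) = suc (qd A)

qdd : FO → ℕ
qdd A = qd A ⊔ 3

-- rooted translation; the auxiliary variable z is chosen as
-- suc (x + y), which differs from both x and y
τ : ℕ → FO → FO
τ x (Rf y z) = Rf y z
τ x (y ≐ z) = y ≐ z
τ x (¬f B) = ¬f (τ x B)
τ x (B ∨f C) = τ x B ∨f τ x C
τ x (∀f y B) =
  ∀f y (((x ≐ y) ∨f ∃f (suc (x + y)) (Rf x (suc (x + y)) ∧f Rf (suc (x + y)) y))
        ⇒f τ x B)

_[_↦_] : {D : Set} → (ℕ → D) → ℕ → D → ℕ → D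
(ρ [ x ↦ d ]) y with Data.Nat._≟_ x y
... | Relation.Nullary.yes _ = d
... | Relation.Nullary.no _ = ρ y

⟦_⟧f : FO → (F : Frame) → (ℕ → W F) → Set
⟦ Rf x y ⟧f F ρ = ¬¬ (R F (ρ x) (ρ y))
⟦ x ≐ y ⟧f F ρ = ¬¬ (ρ x ≡ ρ y)
⟦ ¬f A ⟧f F ρ = ¬ (⟦ A ⟧f F ρ)
⟦ A ∨f B ⟧f F ρ = ¬¬ (⟦ A ⟧f F ρ ⊎ ⟦ B ⟧f F ρ)
⟦ ∀f x A ⟧f F ρ = (d : W F) → ⟦ A ⟧f F (ρ [ x ↦ d ])

_⊨f_ : Frame → FO → Set
F ⊨f A = (ρ : ℕ → W F) → ⟦ A ⟧f F ρ

InTh : (Frame → Set₁) → FO → Set₁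
InTh C A = Sentence A × ((F : Frame) → C F → F ⊨f A)

ModallyDefinable : (Frame → Set₁) → FO → Set₁
ModallyDefinable C A =
  ¬¬ (Σ[ ψ ∈ MF ] ((F : Frame) → C F → (F ⊨ₘ ψ → F ⊨f A) × (F ⊨f A → F ⊨ₘ ψ)))

data N⁻ : Set where
  minus1 : N⁻
  nat    : ℕ → N⁻

toℤ : N⁻ → ℤ
toℤ minus1 = -[1+ 0 ]
toℤ (nat n) = + n

_≤⁻_ : N⁻ → N⁻ → Set
minus1 ≤⁻ _ = ⊤
nat a ≤⁻ minus1 = ⊥
nat a ≤⁻ nat b = a ≤ b

Small : N⁻ → Set
Small n = n ≤⁻ nat 1

plus : ℕ → N⁻ → ℤ
plus m n = (+ m) ℤ.+ toℤ n

Flower : (m : ℕ) → 1 ≤ m → N⁻ → Frame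
Flower m p (nat n) = record
  { W  = Σ[ i ∈ ℕ ] (i ≤ m + n)
  ; R  = λ { (i , _) (j , _) → (i ≡ 0 × 1 ≤ j × j ≤ m) ⊎ (1 ≤ i × 1 ≤ j) }
  ; pt = (0 , z≤n) }
Flower m p minus1 = record
  { W  = Σ[ i ∈ ℕ ] (1 ≤ i × i ≤ m)
  ; R  = λ _ _ → ⊤
  ; pt = (1 , ≤-refl , p) }

InS : Logic → (m : ℕ) → 1 ≤ m → N⁻ → Set₁
InS L m p n = Fr L (Flower m p n)

-- (m , n) ∉ ({1} × N⁻) ∪ (N⁺ × {-1,0,1}),  i.e. m ≥ 2 and n ≥ 2
Big : ℕ → N⁻ → Set
Big m n = 2 ≤ m × (nat 2 ≤⁻ n)

FiniteBigS : Logic → Set₁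
FiniteBigS L = ¬¬ (Σ[ l ∈ List (ℕ × N⁻) ]
  ((m : ℕ) (p : 1 ≤ m) (n : N⁻) → InS L m p n → Big m n → (m , n) ∈ l))

BoundK : Logic → ℕ → Set₁
BoundK L k = (m : ℕ) (p : 1 ≤ m) (n : N⁻) → InS L m p n → Big m n → plus m n ℤ.≤ + k

IsLeastK : Logic → ℕ → Set₁
IsLeastK L k = 4 ≤ k × BoundK L k × ((k' : ℕ) → 4 ≤ k' → BoundK L k' → k ≤ k')

InΠ : ℕ → FO → ℕ → N⁻ → Set
InΠ k A m n =
  (2 ≤ m → nat 2 ≤⁻ n → plus m n ℤ.≤ + k)
  × (m ≡ 1 → n ≤⁻ nat (qdd A))
  × (Small n → m ≤ qdd A)

Cond2 : Logic → MF → ℕ → FO → ℕ → Set₁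
Cond2 L φ k A x =
  InTh (Fr L) (A ⇔f ∀f x (τ x A))
  × ((m m' : ℕ) (p : 1 ≤ m) (p' : 1 ≤ m') (n n' : N⁻) →
       Flower m p n ⊨ₘ φ → InΠ k A m n → m' ≤ m → n' ≤⁻ n →
       Flower m p n ⊨f A → Flower m' p' n' ⊨f A)

{-# OPTIONS --safe #-}

-- In a Euclidean frame the subframe generated by a point w consists of w, the points w sees, and the
-- points reached from w only in two steps; whether one point sees another depends only on which of
-- these three kinds they belong to. So τ(x, A) evaluated at w says that the generated subframe
-- satisfies A, and an Ehrenfeucht–Fraïssé argument shows that a sentence of quantifier depth at most
-- q only depends on the numbers of points of each kind, counted up to q. Counting up to q = qdd(A)
-- assigns to w a bounded shape (a cluster, a flower F_m^n, or a dead end) whose model is a p-morphic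
-- image of the generated subframe.
--
-- (1) ⇒ (2): definable classes are closed under generated subframes and p-morphic images, and smaller
-- flowers are p-morphic images of larger ones. (2) ⇒ (1): the characteristic formula χ(t) is refuted
-- exactly in the frames having a point of shape at least t; A is defined by the conjunction of χ(t)
-- over the finitely many bounded shapes t whose model refutes A, because (2) makes the shapes whose
-- model satisfies A closed downwards.

module Submission where

open import Defs
open import Level using (Level)
open import Data.Bool using (Bool; true; false)
open import Data.Empty using (⊥; ⊥-elim)
open import Data.Irrelevant using (Irrelevant; [_])
open import Data.List using (List; []; _∷_; length; _++_; upTo; map; cartesianProductWith)
open import Data.List.Membership.Propositional using (_∈_)
open import Data.List.Membership.Propositional.Properties using (∈-upTo⁺; ∈-map⁺; ∈-map⁻; ∈-++⁺ˡ; ∈-++⁺ʳ)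
open import Data.List.Properties using (length-upTo)
open import Data.List.Relation.Unary.All using (All; []; _∷_; lookup)
open import Data.List.Relation.Unary.All.Properties using (++⁻)
open import Data.List.Relation.Unary.Any using (here; there)
import Data.List.Relation.Unary.Any.Properties as Any
open import Data.Nat using (ℕ; zero; suc; _+_; _∸_; _≤_; _<_; z≤n; s≤s; _<?_; _≤?_; pred)
open import Data.Nat.Properties
open import Data.Product using (Σ; Σ-syntax; _×_; _,_; proj₁; proj₂)
import Data.Product as Product
open import Data.Sum using (_⊎_; inj₁; inj₂)
import Data.Sum as Sum
open import Data.Unit using (⊤; tt)
open import Function.Base using (_∘_; id)
open import Function.Bundles using (_⇔_; mk⇔; Equivalence)
open import Relation.Binary.Definitions using (DecidableEquality; tri<; tri≈; tri>)
open import Relation.Binary.PropositionalEquality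
open import Relation.Nullary using (¬_; Dec; yes; no)
open import Relation.Nullary.Decidable using (decidable-stable; ¬¬-excluded-middle; map′)
open import Relation.Nullary.Negation using (Stable; negated-stable; contraposition; ¬¬-map)
open import Relation.Nullary.Recomputable using (¬-recompute)

open Equivalence using (to; from)

private
  variable
    a b : Level
    A B : Set a
    X : Set

infixl 1 _>>=_

_>>=_ : ¬¬ A → (A → ¬¬ B) → ¬¬ B
(m >>= f) k = m (λ x → f x k)

return : A → ¬¬ A
return x k = k x

¬¬-rec : Stable B → ¬¬ A → (A → B) → B
¬¬-rec stable m f = stable (λ k → m (λ x → k (f x)))

¬-cong : A ⇔ B → (¬ A) ⇔ (¬ B)
¬-cong A⇔B = mk⇔ (contraposition (from A⇔B)) (contraposition (to A⇔B))

¬¬⊎-cong : {A′ B′ : Set} → A ⇔ A′ → B ⇔ B′ → ¬¬ (A ⊎ B) ⇔ ¬¬ (A′ ⊎ B′)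
¬¬⊎-cong A⇔A′ B⇔B′ = mk⇔ (¬¬-map (Sum.map (to A⇔A′) (to B⇔B′))) (¬¬-map (Sum.map (from A⇔A′) (from B⇔B′)))

⊥-stable : Stable ⊥
⊥-stable h = h (λ z → z)

×-stable : Stable A → Stable B → Stable (A × B)
×-stable sa sb h = sa (λ k → h (λ p → k (proj₁ p))) , sb (λ k → h (λ p → k (proj₂ p)))

Π-stable : {P : A → Set b} → (∀ x → Stable (P x)) → Stable ((x : A) → P x)
Π-stable s h x = s x (λ k → h (λ f → k (f x)))

⟦⟧ₘ-stable : ∀ φ F V w → Stable (⟦ φ ⟧ₘ F V w)
⟦⟧ₘ-stable (var p) F V w = negated-stable
⟦⟧ₘ-stable ⊥ₘ F V w = ⊥-stable
⟦⟧ₘ-stable (¬ₘ φ) F V w = negated-stable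
⟦⟧ₘ-stable (φ ∨ₘ ψ) F V w = negated-stable
⟦⟧ₘ-stable (□ φ) F V w = Π-stable λ v → Π-stable λ _ → ⟦⟧ₘ-stable φ F V v

⟦⟧f-stable : ∀ A F ρ → Stable (⟦ A ⟧f F ρ)
⟦⟧f-stable (Rf x y) F ρ = negated-stable
⟦⟧f-stable (x ≐ y) F ρ = negated-stable
⟦⟧f-stable (¬f A) F ρ = negated-stable
⟦⟧f-stable (A ∨f B) F ρ = negated-stable
⟦⟧f-stable (∀f x A) F ρ = Π-stable λ d → ⟦⟧f-stable A F _

⊨ₘ-stable : ∀ F φ → Stable (F ⊨ₘ φ)
⊨ₘ-stable F φ h V w = ⟦⟧ₘ-stable φ F V w (λ k → h (λ f → k (f V w)))

⊨f-stable : ∀ F A → Stable (F ⊨f A)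
⊨f-stable F A h ρ = ⟦⟧f-stable A F ρ (λ k → h (λ f → k (f ρ)))

update-same : {D : Set} (ρ : ℕ → D) (x : ℕ) (d : D) → (ρ [ x ↦ d ]) x ≡ d
update-same ρ x d with x ≟ x
... | yes _ = refl
... | no x≢x = ⊥-elim (x≢x refl)

update-other : {D : Set} (ρ : ℕ → D) {x y : ℕ} (d : D) → x ≢ y → (ρ [ x ↦ d ]) y ≡ ρ y
update-other ρ {x} {y} d x≢y with x ≟ y
... | yes x≡y = ⊥-elim (x≢y x≡y)
... | no _ = refl

¬¬-filter : (P : A → Set b) (xs : List A) → ¬¬ (Σ[ ys ∈ List A ] ∀ x → x ∈ ys ⇔ (x ∈ xs × P x))
¬¬-filter P [] = return ([] , λ x → mk⇔ (λ ()) (λ ()))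
¬¬-filter P (x ∷ xs) = ¬¬-filter P xs >>= λ { (ys , spec) → ¬¬-excluded-middle {A = P x} >>= λ
  { (yes Px) → return (x ∷ ys , λ y → mk⇔
      (λ { (here refl) → here refl , Px ; (there y∈) → Product.map₁ there (to (spec y) y∈) })
      (λ { (here refl , _) → here refl ; (there y∈ , Py) → there (from (spec y) (y∈ , Py)) }))
  ; (no ¬Px) → return (ys , λ y → mk⇔
      (λ y∈ → Product.map₁ there (to (spec y) y∈))
      (λ { (here refl , Px) → ⊥-elim (¬Px Px) ; (there y∈ , Py) → from (spec y) (y∈ , Py) })) } }

record Bisimulation (F G : Frame) : Set₁ where
  field
    _∼_   : W F → W G → Set
    forth : ∀ {v r v′} → v ∼ r → R F v v′ → ¬¬ (Σ[ r′ ∈ W G ] R G r r′ × v′ ∼ r′)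
    back  : ∀ {v r r′} → v ∼ r → R G r r′ → ¬¬ (Σ[ v′ ∈ W F ] R F v v′ × v′ ∼ r′)

module _ {F G : Frame} (B : Bisimulation F G) where
  open Bisimulation B

  bisimulation-truth : (VF : ℕ → W F → Set) (VG : ℕ → W G → Set) →
    (∀ p {v r} → v ∼ r → ¬¬ VF p v ⇔ ¬¬ VG p r) →
    ∀ φ {v r} → v ∼ r → ⟦ φ ⟧ₘ F VF v ⇔ ⟦ φ ⟧ₘ G VG r
  bisimulation-truth VF VG agree = truth
    where
    truth : ∀ φ {v r} → v ∼ r → ⟦ φ ⟧ₘ F VF v ⇔ ⟦ φ ⟧ₘ G VG r
    truth (var p) v∼r = agree p v∼r
    truth ⊥ₘ v∼r = mk⇔ id id
    truth (¬ₘ φ) v∼r = ¬-cong (truth φ v∼r)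
    truth (φ ∨ₘ ψ) v∼r = ¬¬⊎-cong (truth φ v∼r) (truth ψ v∼r)
    truth (□ φ) v∼r = mk⇔
      (λ h r′ rr′ → ¬¬-rec (⟦⟧ₘ-stable φ G VG r′) (back v∼r rr′)
        λ { (v′ , vv′ , v′∼r′) → to (truth φ v′∼r′) (h v′ vv′) })
      (λ h v′ vv′ → ¬¬-rec (⟦⟧ₘ-stable φ F VF v′) (forth v∼r vv′)
        λ { (r′ , rr′ , v′∼r′) → from (truth φ v′∼r′) (h r′ rr′) })

  Functional : Set
  Functional = ∀ {v r r′} → v ∼ r → v ∼ r′ → ¬¬ (r ≡ r′)

  Surjective : Set
  Surjective = ∀ r → ¬¬ (Σ[ v ∈ W F ] v ∼ r)

  -- Pull the valuation of G back along the relation; functionality makes this faithful.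
  ⊨ₘ-transfer : Functional → Surjective → ∀ φ → F ⊨ₘ φ → G ⊨ₘ φ
  ⊨ₘ-transfer functional surjective φ F⊨φ VG r =
    ¬¬-rec (⟦⟧ₘ-stable φ G VG r) (surjective r)
      λ { (v , v∼r) → to (bisimulation-truth VF VG agree φ v∼r) (F⊨φ VF v) }
    where
    VF : ℕ → W F → Set
    VF p v = Σ[ r′ ∈ W G ] v ∼ r′ × VG p r′
    agree : ∀ p {v r} → v ∼ r → ¬¬ VF p v ⇔ ¬¬ VG p r
    agree p v∼r = mk⇔
      (λ h → h >>= λ { (r′ , v∼r′ , t) → functional v∼r′ v∼r >>= λ { refl → return t } })
      (λ h → h >>= λ t → return (_ , v∼r , t))

record Euclidean (F : Frame) : Set where
  constructor euclidean
  field
    euclid : ∀ {u v v′} → R F u v → R F u v′ → ¬¬ R F v v′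

data Kind : Set where
  root seen unseen : Kind

_≟ᴷ_ : (k l : Kind) → Dec (k ≡ l)
root ≟ᴷ root = yes refl
root ≟ᴷ seen = no λ ()
root ≟ᴷ unseen = no λ ()
seen ≟ᴷ root = no λ ()
seen ≟ᴷ seen = yes refl
seen ≟ᴷ unseen = no λ ()
unseen ≟ᴷ root = no λ ()
unseen ≟ᴷ seen = no λ ()
unseen ≟ᴷ unseen = yes refl

-- Accessibility between kinds, as in a flower; around a point of a Euclidean frame it decides accessibility.
_⇝_ : Kind → Kind → Set
root ⇝ seen = ⊤
root ⇝ _ = ⊥
_ ⇝ root = ⊥
_ ⇝ _ = ⊤

_⇝?_ : ∀ k l → Dec (k ⇝ l)
root ⇝? root = no λ ()
root ⇝? seen = yes tt
root ⇝? unseen = no λ ()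
seen ⇝? root = no λ ()
seen ⇝? seen = yes tt
seen ⇝? unseen = yes tt
unseen ⇝? root = no λ ()
unseen ⇝? seen = yes tt
unseen ⇝? unseen = yes tt

module PointKinds (F : Frame) (w : W F) where

  Generated : W F → Set
  Generated v = ¬¬ (v ≡ w ⊎ Σ[ u ∈ W F ] R F w u × R F u v)

  HasKind : Kind → W F → Set
  HasKind root v = ¬¬ (v ≡ w) × ¬ R F w w
  HasKind seen v = ¬¬ R F w v
  HasKind unseen v = ¬ R F w v × ¬¬ (Σ[ u ∈ W F ] R F w u × R F u v)

  HasKind-stable : ∀ k v → Stable (HasKind k v)
  HasKind-stable root v = ×-stable negated-stable negated-stable
  HasKind-stable seen v = negated-stable
  HasKind-stable unseen v = ×-stable negated-stable negated-stable

module Rooted (F : Frame) (euc : Euclidean F) (w : W F) where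
  open PointKinds F w public
  open Euclidean euc public

  R⇒⇝ : ∀ k l {u v} → HasKind k u → HasKind l v → ¬¬ R F u v → k ⇝ l
  R⇒⇝ root seen _ _ _ = tt
  R⇒⇝ seen seen _ _ _ = tt
  R⇒⇝ seen unseen _ _ _ = tt
  R⇒⇝ unseen seen _ _ _ = tt
  R⇒⇝ unseen unseen _ _ _ = tt
  R⇒⇝ root root (u≡w , ¬ww) (v≡w , _) uv =
    ⊥-elim (uv λ r → u≡w λ { refl → v≡w λ { refl → ¬ww r } })
  R⇒⇝ root unseen (u≡w , _) (¬wv , _) uv = ⊥-elim (uv λ r → u≡w λ { refl → ¬wv r })
  R⇒⇝ seen root _ (v≡w , ¬ww) uv = ⊥-elim (uv λ r → v≡w λ { refl → euclid r r ¬ww })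
  R⇒⇝ unseen root _ (v≡w , ¬ww) uv = ⊥-elim (uv λ r → v≡w λ { refl → euclid r r ¬ww })

  ⇝⇒R : ∀ k l {u v} → HasKind k u → HasKind l v → k ⇝ l → ¬¬ R F u v
  ⇝⇒R root seen (u≡w , _) wv _ = u≡w >>= λ { refl → wv }
  ⇝⇒R seen seen wu wv _ = wu >>= λ wu → wv >>= λ wv → euclid wu wv
  ⇝⇒R seen unseen wu (_ , path) _ =
    wu >>= λ wu → path >>= λ { (a , wa , av) → euclid wa wu >>= λ au → euclid au av }
  ⇝⇒R unseen seen (_ , path) wv _ =
    path >>= λ { (a , wa , au) → wv >>= λ wv → euclid wa wv >>= λ av → euclid au av }
  ⇝⇒R unseen unseen (_ , path) (_ , path′) _ =
    path >>= λ { (a , wa , au) → path′ >>= λ { (b , wb , bv) →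
    euclid wa wb >>= λ ab → euclid ab au >>= λ bu → euclid bu bv } }

  kind-exists : ∀ {v} → Generated v → ¬¬ (Σ[ k ∈ Kind ] HasKind k v)
  kind-exists {v} gen = ¬¬-excluded-middle >>= λ
    { (yes ww) → gen >>= λ
        { (inj₁ refl) → return (seen , return ww)
        ; (inj₂ (a , wa , av)) → euclid wa ww >>= λ aw → euclid aw av >>= λ wv → return (seen , return wv) }
    ; (no ¬ww) → gen >>= λ
        { (inj₁ refl) → return (root , return refl , ¬ww)
        ; (inj₂ path) → ¬¬-excluded-middle >>= λ
            { (yes wv) → return (seen , return wv)
            ; (no ¬wv) → return (unseen , ¬wv , return path) } } }

  kind-generated : ∀ k {v} → HasKind k v → Generated v
  kind-generated root (v≡w , _) = v≡w >>= λ eq → return (inj₁ eq)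
  kind-generated seen wv = wv >>= λ wv → euclid wv wv >>= λ vv → return (inj₂ (_ , wv , vv))
  kind-generated unseen (_ , path) = path >>= λ path → return (inj₂ path)

  kind-unique : ∀ k l {v} → HasKind k v → HasKind l v → k ≡ l
  kind-unique k l {v} hk hl = decidable-stable (k ≟ᴷ l) (λ k≢l → distinct k l hk hl k≢l)
    where
    distinct : ∀ k l → HasKind k v → HasKind l v → k ≢ l → ⊥
    distinct root root _ _ k≢l = k≢l refl
    distinct seen seen _ _ k≢l = k≢l refl
    distinct unseen unseen _ _ k≢l = k≢l refl
    distinct root seen (v≡w , ¬ww) wv _ = v≡w λ { refl → wv ¬ww }
    distinct seen root wv (v≡w , ¬ww) _ = v≡w λ { refl → wv ¬ww }
    distinct root unseen (v≡w , ¬ww) (_ , path) _ =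
      v≡w λ { refl → path λ { (a , wa , aw) → euclid aw aw ¬ww } }
    distinct unseen root (_ , path) (v≡w , ¬ww) _ =
      v≡w λ { refl → path λ { (a , wa , aw) → euclid aw aw ¬ww } }
    distinct seen unseen wv (¬wv , _) _ = wv ¬wv
    distinct unseen seen (¬wv , _) wv _ = wv ¬wv

  Generated-closed : ∀ {u v} → Generated u → R F u v → Generated v
  Generated-closed {u} {v} gen uv = gen >>= λ
    { (inj₁ refl) → euclid uv uv >>= λ vv → return (inj₂ (v , uv , vv))
    ; (inj₂ (a , wa , au)) →
        euclid wa wa >>= λ aa → euclid au aa >>= λ ua → euclid ua uv >>= λ av → return (inj₂ (a , wa , av)) }

InjectiveBelow : ℕ → (ℕ → X) → Set
InjectiveBelow n e = ∀ {i j} → i < n → j < n → e i ≡ e j → i ≡ j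

Distinct : (P : X → Set) → ℕ → Set
Distinct P n = Σ[ e ∈ (ℕ → _) ] (∀ {i} → i < n → P (e i)) × InjectiveBelow n e

-- The P-elements listed without repetition, or just q of them if there are at least q.
record Count (P : X → Set) (q : ℕ) : Set where
  field
    size       : ℕ
    size≤q     : size ≤ q
    elem       : ℕ → X
    elem-P     : ∀ {i} → i < size → P (elem i)
    elem-inj   : InjectiveBelow size elem
    complete   : size < q → ∀ x → P x → ¬¬ (Σ[ i ∈ ℕ ] i < size × x ≡ elem i)

extend : (ℕ → X) → ℕ → X → ℕ → X
extend e n x i with i <? n
... | yes _ = e i
... | no _ = x

extend-< : (e : ℕ → X) (n : ℕ) (x : X) {i : ℕ} → i < n → extend e n x i ≡ e i
extend-< e n x {i} i<n with i <? n
... | yes _ = refl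
... | no i≮n = ⊥-elim (i≮n i<n)

extend-≡ : (e : ℕ → X) (n : ℕ) (x : X) → extend e n x n ≡ x
extend-≡ e n x with n <? n
... | yes n<n = ⊥-elim (<-irrefl refl n<n)
... | no _ = refl

finite-choice : (Q : ℕ → X → Set) (default : X) (n : ℕ) →
  (∀ i → i < n → ¬¬ (Σ X (Q i))) → ¬¬ (Σ[ u ∈ (ℕ → X) ] ∀ i → i < n → Q i (u i))
finite-choice Q d zero h = return ((λ _ → d) , λ i ())
finite-choice Q d (suc n) h =
  finite-choice Q d n (λ i i<n → h i (m<n⇒m<1+n i<n)) >>= λ { (u , Qu) →
  h n ≤-refl >>= λ { (v , Qv) → return (extend u n v , λ i i<1+n → extended u Qu v Qv i i<1+n) } }
  where
  extended : ∀ u → (∀ i → i < n → Q i (u i)) → ∀ v → Q n v → ∀ i → i < suc n → Q i (extend u n v i)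
  extended u Qu v Qv i i<1+n with m<1+n⇒m<n∨m≡n i<1+n
  ... | inj₁ i<n = subst (Q i) (sym (extend-< u n v i<n)) (Qu i i<n)
  ... | inj₂ refl = subst (Q i) (sym (extend-≡ u n v)) Qv

count-or-distinct : (P : X → Set) (default : X) (q n : ℕ) → n ≤ q → ¬¬ (Count P q ⊎ Distinct P n)
count-or-distinct P d q zero _ = return (inj₂ ((λ _ → d) , (λ ()) , (λ ())))
count-or-distinct {X} P d q (suc n) 1+n≤q =
  count-or-distinct P d q n (≤-trans (n≤1+n n) 1+n≤q) >>= λ
    { (inj₁ c) → return (inj₁ c)
    ; (inj₂ (e , eP , e-inj)) → ¬¬-excluded-middle {A = Σ[ x ∈ X ] P x × (∀ i → i < n → x ≢ e i)} >>= λ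
       { (yes (x , Px , new)) → return (inj₂ (extend e n x , (λ {i} → extended-P e eP x Px {i}) , (λ {i} {j} → extended-inj e e-inj x new {i} {j})))
       ; (no none) → return (inj₁ (record
           { size = n ; size≤q = ≤-trans (n≤1+n n) 1+n≤q ; elem = e ; elem-P = eP ; elem-inj = e-inj
           ; complete = λ _ x Px k → none (x , Px , λ i i<n eq → k (i , i<n , eq)) })) } }
  where
  extended-P : (e : ℕ → X) → (∀ {i} → i < n → P (e i)) → ∀ x → P x → ∀ {i} → i < suc n → P (extend e n x i)
  extended-P e eP x Px {i} i<1+n with m<1+n⇒m<n∨m≡n i<1+n
  ... | inj₁ i<n = subst P (sym (extend-< e n x i<n)) (eP i<n)
  ... | inj₂ refl = subst P (sym (extend-≡ e n x)) Px
  extended-inj : (e : ℕ → X) → InjectiveBelow n e → ∀ x → (∀ i → i < n → x ≢ e i) →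
    InjectiveBelow (suc n) (extend e n x)
  extended-inj e e-inj x new {i} {j} i<1+n j<1+n eq
    with m<1+n⇒m<n∨m≡n i<1+n | m<1+n⇒m<n∨m≡n j<1+n
  ... | inj₁ i<n | inj₁ j<n = e-inj i<n j<n (trans (sym (extend-< e n x i<n)) (trans eq (extend-< e n x j<n)))
  ... | inj₂ refl | inj₂ refl = refl
  ... | inj₁ i<n | inj₂ refl = ⊥-elim (new i i<n (sym (trans (sym (extend-< e n x i<n)) (trans eq (extend-≡ e n x)))))
  ... | inj₂ refl | inj₁ j<n = ⊥-elim (new j j<n (trans (sym (extend-≡ e n x)) (trans eq (extend-< e n x j<n))))

count : (P : X → Set) (default : X) (q : ℕ) → ¬¬ (Count P q)
count P d q = count-or-distinct P d q q ≤-refl >>= λ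
  { (inj₁ c) → return c
  ; (inj₂ (e , eP , e-inj)) → return (record
      { size = q ; size≤q = ≤-refl ; elem = e ; elem-P = eP ; elem-inj = e-inj
      ; complete = λ q<q → ⊥-elim (<-irrefl refl q<q) }) }

skip : ℕ → ℕ → ℕ
skip j i with i <? j
... | yes _ = i
... | no _ = suc i

skip-≢ : ∀ j i → skip j i ≢ j
skip-≢ j i eq with i <? j
... | yes i<j = <-irrefl eq i<j
... | no i≮j = i≮j (subst (i <_) eq ≤-refl)

skip-< : ∀ {q} j i → i < q → skip j i < suc q
skip-< j i i<q with i <? j
... | yes _ = m<n⇒m<1+n i<q
... | no _ = s≤s i<q

skip-injective : ∀ j i i′ → skip j i ≡ skip j i′ → i ≡ i′
skip-injective j i i′ eq with i <? j | i′ <? j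
... | yes _ | yes _ = eq
... | no _ | no _ = suc-injective eq
... | yes i<j | no i′≮j = ⊥-elim (i′≮j (≤-trans (n≤1+n (suc i′)) (subst (_< j) eq i<j)))
... | no i≮j | yes i′<j = ⊥-elim (i≮j (≤-trans (n≤1+n (suc i)) (subst (_< j) (sym eq) i′<j)))

pigeonhole : (f : A → X) (vs : List A) (q : ℕ) (e : ℕ → X) → InjectiveBelow q e → length vs < q →
  ¬¬ (Σ[ i ∈ ℕ ] i < q × All (λ v → e i ≢ f v) vs)
pigeonhole f [] (suc q) e e-inj _ = return (0 , s≤s z≤n , [])
pigeonhole {X = X} f (v ∷ vs) q e e-inj len< = ¬¬-excluded-middle {A = Σ[ j ∈ ℕ ] j < q × e j ≡ f v} >>= λ
  { (no miss) → pigeonhole f vs q e e-inj (≤-trans (n≤1+n _) len<) >>= λ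
      { (i , i<q , avoid) → return (i , i<q , (λ eq → miss (i , i<q , eq)) ∷ avoid) }
  ; (yes (j , j<q , hit)) → avoiding-hit q e e-inj len< j j<q hit }
  where
  avoiding-hit : ∀ q (e : ℕ → X) → InjectiveBelow q e → suc (length vs) < q → ∀ j → j < q → e j ≡ f v →
    ¬¬ (Σ[ i ∈ ℕ ] i < q × All (λ v → e i ≢ f v) (v ∷ vs))
  avoiding-hit (suc q) e e-inj (s≤s len<) j j<q hit =
    pigeonhole f vs q (λ i → e (skip j i))
      (λ {i} {i′} i<q i′<q eq → skip-injective j i i′ (e-inj (skip-< j i i<q) (skip-< j i′ i′<q) eq)) len< >>= λ
      { (i , i<q , avoid) → return (skip j i , skip-< j i i<q ,
          (λ eq → skip-≢ j i (e-inj (skip-< j i i<q) j<q (trans eq (sym hit)))) ∷ avoid) }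

record Kinded (G : Frame) : Set where
  field
    kind        : W G → Kind
    _≟ᵂ_        : DecidableEquality (W G)
    rel⇒⇝       : ∀ {r r′} → R G r r′ → kind r ⇝ kind r′
    ⇝⇒rel       : ∀ {r r′} → kind r ⇝ kind r′ → R G r r′
    size        : Kind → ℕ
    point       : Kind → ℕ → W G
    point-kind  : ∀ {k i} → i < size k → kind (point k i) ≡ k
    point-inj   : ∀ {k} → InjectiveBelow (size k) (point k)
    index       : W G → ℕ
    index<size  : ∀ r → index r < size (kind r)
    point-index : ∀ r → point (kind r) (index r) ≡ r

  same-point : ∀ {r r′} → kind r ≡ kind r′ → index r ≡ index r′ → r ≡ r′
  same-point {r} {r′} k≡ i≡ = trans (sym (point-index r)) (trans (cong₂ point k≡ i≡) (point-index r′))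

  index-point : ∀ {k i} → i < size k → index (point k i) ≡ i
  index-point {k} {i} i<size = point-inj
    (subst (λ l → index (point k i) < size l) (point-kind i<size) (index<size (point k i))) i<size
    (trans (cong (λ l → point l (index (point k i))) (sym (point-kind i<size))) (point-index (point k i)))

-- τ x (∀f y B) is ∀f y (guard x y ⇒f τ x B) by definition.
guard : ℕ → ℕ → FO
guard x y = (x ≐ y) ∨f ∃f (suc (x + y)) (Rf x (suc (x + y)) ∧f Rf (suc (x + y)) y)

module _ (F : Frame) (euc : Euclidean F) (w : W F) where
  open Rooted F euc w

  guard-sem : ∀ x y (ρ : ℕ → W F) → ρ x ≡ w → y ≢ x → ∀ d → ⟦ guard x y ⟧f F (ρ [ y ↦ d ]) ⇔ Generated d
  guard-sem x y ρ ρx≡w y≢x d = subst (λ v → ⟦ guard x y ⟧f F σ ⇔ Generated v) (update-same ρ y d) (mk⇔ sound complete)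
    where
    σ : ℕ → W F
    σ = ρ [ y ↦ d ]
    σx≡w : σ x ≡ w
    σx≡w = trans (update-other ρ d y≢x) ρx≡w
    z : ℕ
    z = suc (x + y)
    z≢x : z ≢ x
    z≢x eq = <-irrefl (sym eq) (s≤s (m≤m+n x y))
    z≢y : z ≢ y
    z≢y eq = <-irrefl (sym eq) (s≤s (m≤n+m y x))
    at-x : ∀ e → (σ [ z ↦ e ]) x ≡ w
    at-x e = trans (update-other σ e z≢x) σx≡w
    at-y : ∀ e → (σ [ z ↦ e ]) y ≡ σ y
    at-y e = update-other σ e z≢y
    at-z : ∀ e → (σ [ z ↦ e ]) z ≡ e
    at-z e = update-same σ z e
    sound : ⟦ guard x y ⟧f F σ → Generated (σ y)
    sound h k = h λ
      { (inj₁ x≡y) → x≡y λ eq → k (inj₁ (trans (sym eq) σx≡w))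
      ; (inj₂ path) → path λ e ¬both → ¬both λ either →
          either (inj₁ λ ¬wz → either (inj₂ λ ¬zy → ¬wz λ wz → ¬zy λ zy →
            k (inj₂ (e , subst₂ (R F) (at-x e) (at-z e) wz , subst₂ (R F) (at-z e) (at-y e) zy)))) }
    complete : Generated (σ y) → ⟦ guard x y ⟧f F σ
    complete gen k = gen λ
      { (inj₁ eq) → k (inj₁ (return (trans σx≡w (sym eq))))
      ; (inj₂ (a , wa , ay)) → k (inj₂ λ none → none a λ either → either λ
          { (inj₁ ¬wa) → ¬wa (return (subst₂ (R F) (sym (at-x a)) (sym (at-z a)) wa))
          ; (inj₂ ¬ay) → ¬ay (return (subst₂ (R F) (sym (at-z a)) (sym (at-y a)) ay)) }) }

-- An Ehrenfeucht–Fraïssé game for the rooted translation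

module RootedTranslation (F : Frame) (euc : Euclidean F) (w : W F) (q : ℕ)
  (counts : (k : Kind) → Count (Rooted.HasKind F euc w k) q)
  (G : Frame) (K : Kinded G) (same-size : ∀ k → Kinded.size K k ≡ Count.size (counts k)) where
  open Rooted F euc w
  open Kinded K

  elem : Kind → ℕ → W F
  elem k = Count.elem (counts k)

  private
    to-count : ∀ {k i} → i < size k → i < Count.size (counts k)
    to-count {k} = subst (_ <_) (same-size k)

  elem-kind : ∀ {k i} → i < size k → HasKind k (elem k i)
  elem-kind {k} i<size = Count.elem-P (counts k) (to-count i<size)

  elem-inj : ∀ {k} → InjectiveBelow (size k) (elem k)
  elem-inj {k} i<size j<size = Count.elem-inj (counts k) (to-count i<size) (to-count j<size)

  elem-complete : ∀ {k} → size k < q → ∀ v → HasKind k v → ¬¬ (Σ[ i ∈ ℕ ] i < size k × v ≡ elem k i)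
  elem-complete {k} size<q v v:k =
    Count.complete (counts k) (subst (_< q) (same-size k) size<q) v v:k >>= λ
      { (i , i<c , eq) → return (i , subst (i <_) (sym (same-size k)) i<c , eq) }

  saturated : ∀ k → ¬ (size k < q) → size k ≡ q
  saturated k size≮q = ≤-antisym (subst (_≤ q) (sym (same-size k)) (Count.size≤q (counts k))) (≮⇒≥ size≮q)

  -- Unsaturated kinds (fewer than q points) are matched index by index; saturated kinds have at least q points
  -- on both sides, enough to find a fresh partner against the fewer than q points already matched.
  Canonical : W F → W G → Set
  Canonical d r = size (kind r) < q → ¬¬ (d ≡ elem (kind r) (index r))

  record Matching (Vs : List ℕ) (ρ : ℕ → W F) (ρ′ : ℕ → W G) : Set where
    field
      kind-match : ∀ {y} → y ∈ Vs → HasKind (kind (ρ′ y)) (ρ y)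
      canonical  : ∀ {y} → y ∈ Vs → Canonical (ρ y) (ρ′ y)
      eq-match   : ∀ {y z} → y ∈ Vs → z ∈ Vs → ¬¬ (ρ y ≡ ρ z) ⇔ (ρ′ y ≡ ρ′ z)
  open Matching

  record Extension (Vs : List ℕ) (ρ : ℕ → W F) (ρ′ : ℕ → W G) (d : W F) (r : W G) : Set where
    field
      new-kind      : HasKind (kind r) d
      new-canonical : Canonical d r
      new-eq        : ∀ {z} → z ∈ Vs → ¬¬ (d ≡ ρ z) ⇔ (r ≡ ρ′ z)
  open Extension

  matching-empty : ∀ ρ ρ′ → Matching [] ρ ρ′
  matching-empty ρ ρ′ = record { kind-match = λ () ; canonical = λ () ; eq-match = λ () }

  private
    data NewOrOld (y z : ℕ) (Vs : List ℕ) : Set where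
      new : z ≡ y → NewOrOld y z Vs
      old : y ≢ z → z ∈ Vs → NewOrOld y z Vs

    new-or-old : ∀ {y z Vs} → z ∈ (y ∷ Vs) → NewOrOld y z Vs
    new-or-old {y} {z} z∈ with z ≟ y
    new-or-old z∈ | yes z≡y = new z≡y
    new-or-old (here z≡y) | no z≢y = ⊥-elim (z≢y z≡y)
    new-or-old (there z∈) | no z≢y = old (λ y≡z → z≢y (sym y≡z)) z∈

  matching-extend : ∀ {Vs ρ ρ′ d r} y → Matching Vs ρ ρ′ → Extension Vs ρ ρ′ d r →
    Matching (y ∷ Vs) (ρ [ y ↦ d ]) (ρ′ [ y ↦ r ])
  matching-extend {Vs} {ρ} {ρ′} {d} {r} y I E = record { kind-match = km ; canonical = cn ; eq-match = em }
    where
    km : ∀ {z} → z ∈ (y ∷ Vs) → HasKind (kind ((ρ′ [ y ↦ r ]) z)) ((ρ [ y ↦ d ]) z)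
    km z∈ with new-or-old z∈
    ... | new refl rewrite update-same ρ y d | update-same ρ′ y r = new-kind E
    ... | old y≢z z∈Vs rewrite update-other ρ d y≢z | update-other ρ′ r y≢z = kind-match I z∈Vs
    cn : ∀ {z} → z ∈ (y ∷ Vs) → Canonical ((ρ [ y ↦ d ]) z) ((ρ′ [ y ↦ r ]) z)
    cn z∈ with new-or-old z∈
    ... | new refl rewrite update-same ρ y d | update-same ρ′ y r = new-canonical E
    ... | old y≢z z∈Vs rewrite update-other ρ d y≢z | update-other ρ′ r y≢z = canonical I z∈Vs
    em : ∀ {z z′} → z ∈ (y ∷ Vs) → z′ ∈ (y ∷ Vs) →
      ¬¬ ((ρ [ y ↦ d ]) z ≡ (ρ [ y ↦ d ]) z′) ⇔ ((ρ′ [ y ↦ r ]) z ≡ (ρ′ [ y ↦ r ]) z′)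
    em z∈ z′∈ with new-or-old z∈ | new-or-old z′∈
    ... | new refl | new refl = mk⇔ (λ _ → refl) (λ _ → return refl)
    ... | new refl | old y≢z′ z′∈Vs
      rewrite update-same ρ y d | update-same ρ′ y r | update-other ρ d y≢z′ | update-other ρ′ r y≢z′ =
      new-eq E z′∈Vs
    ... | old y≢z z∈Vs | new refl
      rewrite update-same ρ y d | update-same ρ′ y r | update-other ρ d y≢z | update-other ρ′ r y≢z =
      mk⇔ (λ h → sym (to (new-eq E z∈Vs) (¬¬-map sym h)))
          (λ eq → ¬¬-map sym (from (new-eq E z∈Vs) (sym eq)))
    ... | old y≢z z∈Vs | old y≢z′ z′∈Vs
      rewrite update-other ρ d y≢z | update-other ρ′ r y≢z | update-other ρ d y≢z′ | update-other ρ′ r y≢z′ =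
      eq-match I z∈Vs z′∈Vs

  module _ (Vs : List ℕ) (ρ : ℕ → W F) (ρ′ : ℕ → W G) (I : Matching Vs ρ ρ′) (|Vs|<q : length Vs < q) where

    canonical-eq : ∀ d r → HasKind (kind r) d → size (kind r) < q → ¬¬ (d ≡ elem (kind r) (index r)) →
      ∀ {z} → z ∈ Vs → ¬¬ (d ≡ ρ z) ⇔ (r ≡ ρ′ z)
    canonical-eq d r d:r size<q d≡ {z} z∈ = mk⇔ same-in-G same-in-F
      where
      same-in-G : ¬¬ (d ≡ ρ z) → r ≡ ρ′ z
      same-in-G h = decidable-stable (r ≟ᵂ ρ′ z) (h >>= λ { refl → d≡ >>= λ d≡′ →
        let k≡ : kind r ≡ kind (ρ′ z)
            k≡ = kind-unique _ _ d:r (kind-match I z∈)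
        in canonical I z∈ (subst (λ k → size k < q) k≡ size<q) >>= λ ρz≡ →
        return (same-point k≡ (elem-inj (index<size r)
          (subst (λ k → index (ρ′ z) < size k) (sym k≡) (index<size (ρ′ z)))
          (trans (sym d≡′) (trans ρz≡ (cong (λ k → elem k (index (ρ′ z))) (sym k≡)))))) })
      same-in-F : r ≡ ρ′ z → ¬¬ (d ≡ ρ z)
      same-in-F refl = canonical I z∈ size<q >>= λ ρz≡ → d≡ >>= λ d≡′ → return (trans d≡′ (sym ρz≡))

    preimage : (r : W G) (Us : List ℕ) → (Σ[ z ∈ ℕ ] z ∈ Us × ρ′ z ≡ r) ⊎ All (λ z → ρ′ z ≢ r) Us
    preimage r [] = inj₂ []
    preimage r (u ∷ Us) with ρ′ u ≟ᵂ r
    ... | yes eq = inj₁ (u , here refl , eq)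
    ... | no neq with preimage r Us
    ...   | inj₁ (z , z∈ , eq) = inj₁ (z , there z∈ , eq)
    ...   | inj₂ none = inj₂ (neq ∷ none)

    forth-step : (r : W G) → ¬¬ (Σ[ d ∈ W F ] Generated d × Extension Vs ρ ρ′ d r)
    forth-step r with size (kind r) <? q
    ... | yes size<q = return (elem (kind r) (index r) , kind-generated _ d:r ,
          record { new-kind = d:r ; new-canonical = λ _ → return refl
                 ; new-eq = canonical-eq _ r d:r size<q (return refl) })
      where
      d:r : HasKind (kind r) (elem (kind r) (index r))
      d:r = elem-kind (index<size r)
    ... | no size≮q with preimage r Vs
    ...   | inj₁ (z , z∈ , refl) = return (ρ z , kind-generated _ (kind-match I z∈) ,
          record { new-kind = kind-match I z∈ ; new-canonical = λ size<q → ⊥-elim (size≮q size<q)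
                 ; new-eq = eq-match I z∈ })
    ...   | inj₂ none = pigeonhole ρ Vs q (elem k) (subst (λ n → InjectiveBelow n (elem k)) sat elem-inj) |Vs|<q >>= λ
          { (i , i<q , fresh) → return (elem k i , kind-generated _ (elem-kind (i<size i<q)) ,
              record { new-kind = elem-kind (i<size i<q) ; new-canonical = λ size<q → ⊥-elim (size≮q size<q)
                     ; new-eq = λ z∈ → mk⇔ (λ h → ⊥-elim (h (lookup fresh z∈)))
                                             (λ eq → ⊥-elim (lookup none z∈ (sym eq))) }) }
      where
      k : Kind
      k = kind r
      sat : size k ≡ q
      sat = saturated k size≮q
      i<size : ∀ {i} → i < q → i < size k
      i<size = subst (_ <_) (sym sat)

    back-step : (d : W F) (k : Kind) → HasKind k d → ¬¬ (Σ[ r ∈ W G ] Extension Vs ρ ρ′ d r)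
    back-step d k d:k with size k <? q
    ... | yes size<q = elem-complete size<q d d:k >>= λ { (i , i<size , d≡) →
          let k≡ : kind (point k i) ≡ k
              k≡ = point-kind i<size
              d≡′ : ¬¬ (d ≡ elem (kind (point k i)) (index (point k i)))
              d≡′ = return (trans d≡ (cong₂ elem (sym k≡) (sym (index-point i<size))))
              d:r = subst (λ l → HasKind l d) (sym k≡) d:k
              size<q′ = subst (λ l → size l < q) (sym k≡) size<q
          in return (point k i , record { new-kind = d:r ; new-canonical = λ _ → d≡′
                                        ; new-eq = canonical-eq d (point k i) d:r size<q′ d≡′ }) }
    ... | no size≮q = ¬¬-excluded-middle {A = Σ[ z ∈ ℕ ] z ∈ Vs × ¬¬ (ρ z ≡ d)} >>= λ
          { (yes (z , z∈ , ρz≡d)) →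
              let d:z : HasKind (kind (ρ′ z)) d
                  d:z = HasKind-stable _ d (ρz≡d >>= λ { refl → return (kind-match I z∈) })
                  k≡ : kind (ρ′ z) ≡ k
                  k≡ = kind-unique _ _ d:z d:k
              in return (ρ′ z , record
                   { new-kind = d:z
                   ; new-canonical = λ size<q → ⊥-elim (size≮q (subst (λ l → size l < q) k≡ size<q))
                   ; new-eq = λ z′∈ → mk⇔
                       (λ d≡ → to (eq-match I z∈ z′∈) (ρz≡d >>= λ e₁ → d≡ >>= λ e₂ → return (trans e₁ e₂)))
                       (λ eq → from (eq-match I z∈ z′∈) eq >>= λ e₂ → ρz≡d >>= λ e₁ → return (trans (sym e₁) e₂)) })
          ; (no unused) → pigeonhole ρ′ Vs q (point k) (subst (λ n → InjectiveBelow n (point k)) sat point-inj) |Vs|<q >>= λ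
              { (i , i<q , fresh) →
                let k≡ : kind (point k i) ≡ k
                    k≡ = point-kind (subst (_ <_) (sym sat) i<q)
                in return (point k i , record
                     { new-kind = subst (λ l → HasKind l d) (sym k≡) d:k
                     ; new-canonical = λ size<q → ⊥-elim (size≮q (subst (λ l → size l < q) k≡ size<q))
                     ; new-eq = λ {z} z∈ → mk⇔ (λ d≡ → ⊥-elim (unused (z , z∈ , ¬¬-map sym d≡)))
                                               (λ eq → ⊥-elim (lookup fresh z∈ eq)) }) } }
      where
      sat : size k ≡ q
      sat = saturated k size≮q

  τ-agreement-∀ : ∀ x y B Vs ρ ρ′ → ρ x ≡ w → y ≢ x → length Vs < q → Matching Vs ρ ρ′ →
    (∀ d r → Matching (y ∷ Vs) (ρ [ y ↦ d ]) (ρ′ [ y ↦ r ]) → ⟦ τ x B ⟧f F (ρ [ y ↦ d ]) ⇔ ⟦ B ⟧f G (ρ′ [ y ↦ r ])) →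
    ⟦ τ x (∀f y B) ⟧f F ρ ⇔ ⟦ ∀f y B ⟧f G ρ′
  τ-agreement-∀ x y B Vs ρ ρ′ ρx≡w y≢x |Vs|<q I IH = mk⇔ forth back
    where
    guarded : ∀ d → ⟦ guard x y ⟧f F (ρ [ y ↦ d ]) ⇔ Generated d
    guarded = guard-sem F euc w x y ρ ρx≡w y≢x
    forth : ⟦ τ x (∀f y B) ⟧f F ρ → ⟦ ∀f y B ⟧f G ρ′
    forth h r = ¬¬-rec (⟦⟧f-stable B G _) (forth-step Vs ρ ρ′ I |Vs|<q r) λ { (d , gen , E) →
      ¬¬-rec (⟦⟧f-stable B G _) (h d) λ
        { (inj₁ unguarded) → ⊥-elim (unguarded (from (guarded d) gen))
        ; (inj₂ t) → to (IH d r (matching-extend y I E)) t } }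
    back : ⟦ ∀f y B ⟧f G ρ′ → ⟦ τ x (∀f y B) ⟧f F ρ
    back h d = ¬¬-excluded-middle {A = Generated d} >>= λ
      { (no ¬gen) → return (inj₁ (¬gen ∘ to (guarded d)))
      ; (yes gen) → kind-exists gen >>= λ { (k , d:k) → back-step Vs ρ ρ′ I |Vs|<q d k d:k >>= λ
          { (r , E) → return (inj₂ (from (IH d r (matching-extend y I E)) (h r))) } } }

  τ-agreement : (x : ℕ) → ∀ B Vs ρ ρ′ → (∀ {y} → FreeIn y B → y ∈ Vs) → length Vs + qd B ≤ q → ¬ OccursIn x B →
    ρ x ≡ w → Matching Vs ρ ρ′ → ⟦ τ x B ⟧f F ρ ⇔ ⟦ B ⟧f G ρ′
  τ-agreement x (Rf y z) Vs ρ ρ′ fv _ _ _ I = mk⇔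
    (λ h → return (⇝⇒rel (R⇒⇝ _ _ (kind-match I (fv rl)) (kind-match I (fv rr)) h)))
    (λ h → ⇝⇒R _ _ (kind-match I (fv rl)) (kind-match I (fv rr)) (decidable-stable (_ ⇝? _) (¬¬-map rel⇒⇝ h)))
  τ-agreement x (y ≐ z) Vs ρ ρ′ fv _ _ _ I = mk⇔
    (λ h → return (to (eq-match I (fv el) (fv er)) h))
    (λ h → h >>= from (eq-match I (fv el) (fv er)))
  τ-agreement x (¬f B) Vs ρ ρ′ fv bound x∉ ρx≡w I =
    ¬-cong (τ-agreement x B Vs ρ ρ′ (fv ∘ ng) bound (x∉ ∘ ng) ρx≡w I)
  τ-agreement x (B ∨f C) Vs ρ ρ′ fv bound x∉ ρx≡w I = ¬¬⊎-cong
    (τ-agreement x B Vs ρ ρ′ (fv ∘ ol) (≤-trans (+-monoʳ-≤ (length Vs) (m≤m⊔n (qd B) (qd C))) bound) (x∉ ∘ ol) ρx≡w I)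
    (τ-agreement x C Vs ρ ρ′ (fv ∘ or) (≤-trans (+-monoʳ-≤ (length Vs) (m≤n⊔m (qd B) (qd C))) bound) (x∉ ∘ or) ρx≡w I)
  τ-agreement x (∀f y B) Vs ρ ρ′ fv bound x∉ ρx≡w I =
    τ-agreement-∀ x y B Vs ρ ρ′ ρx≡w y≢x |Vs|<q I λ d r →
      τ-agreement x B (y ∷ Vs) (ρ [ y ↦ d ]) (ρ′ [ y ↦ r ]) fv′ bound′ (x∉ ∘ al) (trans (update-other ρ d y≢x) ρx≡w)
    where
    y≢x : y ≢ x
    y≢x refl = x∉ ab
    fv′ : ∀ {z} → FreeIn z B → z ∈ (y ∷ Vs)
    fv′ {z} free with z ≟ y
    ... | yes z≡y = here z≡y
    ... | no z≢y = there (fv (al z≢y free))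
    bound′ : length (y ∷ Vs) + qd B ≤ q
    bound′ = subst (_≤ q) (+-suc (length Vs) (qd B)) bound
    |Vs|<q : length Vs < q
    |Vs|<q = ≤-trans (s≤s (m≤m+n (length Vs) (qd B))) bound′

  τ-agreement-sentence : (x : ℕ) → ∀ A → Sentence A → ¬ OccursIn x A → qd A ≤ q → ∀ ρ → ρ x ≡ w → ⟦ τ x A ⟧f F ρ ⇔ G ⊨f A
  τ-agreement-sentence x A closed x∉ bound ρ ρx≡w = mk⇔
    (λ h ρ′ → to (agree ρ′) h)
    (λ h → from (agree (λ _ → pt G)) (h _))
    where
    agree : ∀ ρ′ → ⟦ τ x A ⟧f F ρ ⇔ ⟦ A ⟧f G ρ′
    agree ρ′ = τ-agreement x A [] ρ ρ′ (λ {y} free → ⊥-elim (closed y free)) bound x∉ ρx≡w (matching-empty ρ ρ′)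

private
  pair-≡ : {P : ℕ → Set} → (∀ {i} (p p′ : P i) → p ≡ p′) → ∀ {i j} {p : P i} {p′ : P j} →
    i ≡ j → _≡_ {A = Σ ℕ P} (i , p) (j , p′)
  pair-≡ irrelevant refl = cong (_ ,_) (irrelevant _ _)

  ≤×≤-irrelevant : ∀ {a b c : ℕ} (p p′ : a ≤ b × b ≤ c) → p ≡ p′
  ≤×≤-irrelevant (p₁ , p₂) (p′₁ , p′₂) = cong₂ _,_ (≤-irrelevant p₁ p′₁) (≤-irrelevant p₂ p′₂)

module FlowerKinds (m : ℕ) (1≤m : 1 ≤ m) (n : ℕ) where
  G : Frame
  G = Flower m 1≤m (nat n)

  -- Out-of-range indices are sent to the root; they never occur below.
  at : ℕ → W G
  at j with j ≤? m + n
  ... | yes j≤ = (j , j≤)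
  ... | no _ = (0 , z≤n)

  at-≡ : ∀ {j} (j≤ : j ≤ m + n) → at j ≡ (j , j≤)
  at-≡ {j} j≤ with j ≤? m + n
  ... | yes _ = pair-≡ ≤-irrelevant refl
  ... | no j≰ = ⊥-elim (j≰ j≤)

  kind-of : ℕ → Kind
  kind-of zero = root
  kind-of (suc i) with suc i ≤? m
  ... | yes _ = seen
  ... | no _ = unseen

  data KindView : ℕ → Kind → Set where
    is-root   : KindView 0 root
    is-seen   : ∀ {j} → 1 ≤ j → j ≤ m → KindView j seen
    is-unseen : ∀ {j} → m < j → KindView j unseen

  kind-view : ∀ j → KindView j (kind-of j)
  kind-view zero = is-root
  kind-view (suc i) with suc i ≤? m
  ... | yes 1+i≤m = is-seen (s≤s z≤n) 1+i≤m
  ... | no 1+i≰m = is-unseen (≰⇒> 1+i≰m)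

  kind-view-unique : ∀ {j k} → KindView j k → kind-of j ≡ k
  kind-view-unique is-root = refl
  kind-view-unique (is-seen {suc i} _ j≤m) with suc i ≤? m
  ... | yes _ = refl
  ... | no j≰m = ⊥-elim (j≰m j≤m)
  kind-view-unique (is-unseen {suc i} m<j) with suc i ≤? m
  ... | yes j≤m = ⊥-elim (<-irrefl refl (<-≤-trans m<j j≤m))
  ... | no _ = refl

  rel⇒⇝ : ∀ {r r′} → R G r r′ → kind-of (proj₁ r) ⇝ kind-of (proj₁ r′)
  rel⇒⇝ {i , _} {j , _} rel with kind-of i | kind-view i | kind-of j | kind-view j | rel
  ... | _ | is-root | _ | is-seen _ _ | _ = tt
  ... | _ | is-seen _ _ | _ | is-seen _ _ | _ = tt
  ... | _ | is-seen _ _ | _ | is-unseen _ | _ = tt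
  ... | _ | is-unseen _ | _ | is-seen _ _ | _ = tt
  ... | _ | is-unseen _ | _ | is-unseen _ | _ = tt
  ... | _ | _ | _ | is-root | inj₁ (_ , () , _)
  ... | _ | _ | _ | is-root | inj₂ (_ , ())
  ... | _ | is-root | _ | is-unseen m<j | inj₁ (_ , _ , j≤m) = ⊥-elim (<-irrefl refl (<-≤-trans m<j j≤m))
  ... | _ | is-root | _ | is-unseen _ | inj₂ (() , _)

  ⇝⇒rel : ∀ {r r′} → kind-of (proj₁ r) ⇝ kind-of (proj₁ r′) → R G r r′
  ⇝⇒rel {i , _} {j , _} ⇝ with kind-of i | kind-view i | kind-of j | kind-view j | ⇝
  ... | _ | is-root | _ | is-seen 1≤j j≤m | _ = inj₁ (refl , 1≤j , j≤m)
  ... | _ | is-seen 1≤i _ | _ | is-seen 1≤j _ | _ = inj₂ (1≤i , 1≤j)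
  ... | _ | is-seen 1≤i _ | _ | is-unseen m<j | _ = inj₂ (1≤i , ≤-trans 1≤m (<⇒≤ m<j))
  ... | _ | is-unseen m<i | _ | is-seen 1≤j _ | _ = inj₂ (≤-trans 1≤m (<⇒≤ m<i) , 1≤j)
  ... | _ | is-unseen m<i | _ | is-unseen m<j | _ = inj₂ (≤-trans 1≤m (<⇒≤ m<i) , ≤-trans 1≤m (<⇒≤ m<j))

  size : Kind → ℕ
  size root = 1
  size seen = m
  size unseen = n

  position : Kind → ℕ → ℕ
  position root i = 0
  position seen i = suc i
  position unseen i = suc (m + i)

  position≤ : ∀ {k i} → i < size k → position k i ≤ m + n
  position≤ {root} _ = z≤n
  position≤ {seen} i<m = ≤-trans i<m (m≤m+n m n)
  position≤ {unseen} {i} i<n = subst (_≤ m + n) (+-suc m i) (+-monoʳ-≤ m i<n)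

  position-view : ∀ {k i} → i < size k → KindView (position k i) k
  position-view {root} _ = is-root
  position-view {seen} i<m = is-seen (s≤s z≤n) i<m
  position-view {unseen} {i} _ = is-unseen (s≤s (m≤m+n m i))

  position-inj : ∀ {k} → InjectiveBelow (size k) (position k)
  position-inj {root} (s≤s z≤n) (s≤s z≤n) _ = refl
  position-inj {seen} _ _ eq = suc-injective eq
  position-inj {unseen} _ _ eq = +-cancelˡ-≡ m _ _ (suc-injective eq)

  index-of : ∀ {j k} → KindView j k → ℕ
  index-of is-root = 0
  index-of {j} (is-seen _ _) = pred j
  index-of {j} (is-unseen _) = j ∸ suc m

  index-of< : ∀ {j k} → j ≤ m + n → (v : KindView j k) → index-of v < size k
  index-of< _ is-root = s≤s z≤n
  index-of< _ (is-seen (s≤s z≤n) j≤m) = j≤m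
  index-of< {j} j≤ (is-unseen m<j) = +-cancelˡ-≤ m (suc (j ∸ suc m)) n
    (subst (_≤ m + n) (sym (+-suc m (j ∸ suc m))) (subst (_≤ m + n) (sym (m+[n∸m]≡n m<j)) j≤))

  position-index-of : ∀ {j k} (v : KindView j k) → position k (index-of v) ≡ j
  position-index-of is-root = refl
  position-index-of (is-seen (s≤s z≤n) _) = refl
  position-index-of (is-unseen m<j) = m+[n∸m]≡n m<j

  flower-kinded : Kinded G
  flower-kinded = record
    { kind = λ r → kind-of (proj₁ r)
    ; _≟ᵂ_ = λ { (i , _) (j , _) → map′ (pair-≡ ≤-irrelevant) (cong proj₁) (i ≟ j) }
    ; rel⇒⇝ = λ {r} {r′} → rel⇒⇝ {r} {r′}
    ; ⇝⇒rel = λ {r} {r′} → ⇝⇒rel {r} {r′}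
    ; size = size
    ; point = λ k i → at (position k i)
    ; point-kind = λ {k} i<size → trans (cong kind-of (cong proj₁ (at-≡ (position≤ i<size))))
                                        (kind-view-unique (position-view i<size))
    ; point-inj = λ {k} i<size j<size eq → position-inj i<size j<size
        (trans (cong proj₁ (sym (at-≡ (position≤ i<size)))) (trans (cong proj₁ eq) (cong proj₁ (at-≡ (position≤ j<size)))))
    ; index = λ r → index-of (kind-view (proj₁ r))
    ; index<size = λ { (j , j≤) → index-of< j≤ (kind-view j) }
    ; point-index = λ { (j , j≤) → trans (cong at (position-index-of (kind-view j))) (at-≡ j≤) }
    }

module ClusterKinds (c : ℕ) (1≤c : 1 ≤ c) where
  G : Frame
  G = Flower c 1≤c minus1

  at : ℕ → W G
  at j with 1 ≤? j | j ≤? c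
  ... | yes 1≤j | yes j≤c = (j , 1≤j , j≤c)
  ... | _ | _ = (1 , ≤-refl , 1≤c)

  at-≡ : ∀ {j} (j∈ : 1 ≤ j × j ≤ c) → at j ≡ (j , j∈)
  at-≡ {j} (1≤j , j≤c) with 1 ≤? j | j ≤? c
  ... | yes _ | yes _ = pair-≡ ≤×≤-irrelevant refl
  ... | no 1≰j | _ = ⊥-elim (1≰j 1≤j)
  ... | yes _ | no j≰c = ⊥-elim (j≰c j≤c)

  size : Kind → ℕ
  size seen = c
  size _ = 0

  cluster-kinded : Kinded G
  cluster-kinded = record
    { kind = λ _ → seen
    ; _≟ᵂ_ = λ { (i , _) (j , _) → map′ (pair-≡ ≤×≤-irrelevant) (cong proj₁) (i ≟ j) }
    ; rel⇒⇝ = λ _ → tt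
    ; ⇝⇒rel = λ _ → tt
    ; size = size
    ; point = λ _ i → at (suc i)
    ; point-kind = λ { {seen} _ → refl }
    ; point-inj = λ { {seen} i<c j<c eq → suc-injective
        (trans (cong proj₁ (sym (at-≡ (s≤s z≤n , i<c)))) (trans (cong proj₁ eq) (cong proj₁ (at-≡ (s≤s z≤n , j<c))))) }
    ; index = λ r → pred (proj₁ r)
    ; index<size = λ { (suc j , s≤s z≤n , j<c) → j<c }
    ; point-index = λ { (suc j , s≤s z≤n , j<c) → at-≡ _ }
    }

DeadEnd : Frame
DeadEnd = record { W = ⊤ ; R = λ _ _ → ⊥ ; pt = tt }

deadEnd-kinded : Kinded DeadEnd
deadEnd-kinded = record
  { kind = λ _ → root
  ; _≟ᵂ_ = λ _ _ → yes refl
  ; rel⇒⇝ = λ ()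
  ; ⇝⇒rel = λ ()
  ; size = size
  ; point = λ _ _ → tt
  ; point-kind = λ { {root} _ → refl }
  ; point-inj = λ { {root} (s≤s z≤n) (s≤s z≤n) _ → refl }
  ; index = λ _ → 0
  ; index<size = λ _ → s≤s z≤n
  ; point-index = λ _ → refl
  }
  where
  size : Kind → ℕ
  size root = 1
  size _ = 0

-- Points of kind k are sent to points of kind κ k; section l i is a point of F sent to the i-th point of kind l.
record Collapse (F : Frame) (euc : Euclidean F) (w : W F) (G : Frame) (K : Kinded G) : Set where
  open Rooted F euc w
  open Kinded K
  field
    κ            : Kind → Kind
    κ-⇝          : ∀ {k l} → k ⇝ l → κ k ⇝ κ l
    κ-⇝-back     : ∀ {k l} → 0 < size l → κ k ⇝ l → k ⇝ l
    κ-fixed      : ∀ {l} → 0 < size l → κ l ≡ l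
    κ-inhabited  : ∀ {k v} → HasKind k v → 0 < size (κ k)
    section      : Kind → ℕ → W F
    section-kind : ∀ {l i} → i < size l → HasKind l (section l i)
    section-inj  : ∀ {l} → InjectiveBelow (size l) (section l)

module _ {F : Frame} {euc : Euclidean F} {w : W F} {G : Frame} {K : Kinded G} (C : Collapse F euc w G K) where
  open Rooted F euc w
  open Kinded K
  open Collapse C

  private
    Above : Kind → W F → Set
    Above l v = ¬¬ (Σ[ k ∈ Kind ] HasKind k v × κ k ≡ l)

    above-unique : ∀ {l l′ v} → Above l v → Above l′ v → l ≡ l′
    above-unique {l} {l′} h h′ = decidable-stable (l ≟ᴷ l′) (h >>= λ { (k , v:k , refl) → h′ >>= λ { (k′ , v:k′ , refl) →
      return (cong κ (kind-unique k k′ v:k v:k′)) } })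

    above-generated : ∀ {l v} → Above l v → Generated v
    above-generated h = negated-stable (h >>= λ { (k , v:k , _) → return (kind-generated k v:k) })

    above-inhabited : ∀ {l v} → Above l v → 0 < size l
    above-inhabited {l} h = decidable-stable (0 <? size l) (h >>= λ { (k , v:k , refl) → return (κ-inhabited v:k) })

    above-⇝ : ∀ {l l′ v v′} → Above l v → Above l′ v′ → R F v v′ → l ⇝ l′
    above-⇝ {l} {l′} h h′ vv′ = decidable-stable (l ⇝? l′) (h >>= λ { (k , v:k , refl) → h′ >>= λ { (k′ , v′:k′ , refl) →
      return (κ-⇝ (R⇒⇝ k k′ v:k v′:k′ (return vv′))) } })

    section-above : ∀ {l i} → i < size l → Above l (section l i)
    section-above {l} i<size = return (l , section-kind i<size , κ-fixed (≤-<-trans z≤n i<size))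

    -- v is sent to the point of index i of kind l: to index 0 unless it is one of the chosen sections.
    Sent : W F → Kind → ℕ → Set
    Sent v l i = Above l v × (i ≡ 0 → ∀ j → 1 ≤ j → j < size l → v ≢ section l j) × (i ≢ 0 → ¬¬ (v ≡ section l i))

    _↦_ : W F → W G → Set
    v ↦ r = Sent v (kind r) (index r)

    sent-point : ∀ {l i v} → i < size l → Sent v l i → v ↦ point l i
    sent-point {l} {i} {v} i<size =
      subst₂ (Sent v) (sym (point-kind i<size)) (sym (index-point i<size))

    section-sent : ∀ r → section (kind r) (index r) ↦ r
    section-sent r = section-above (index<size r) ,
      (λ i≡0 j 1≤j j<size eq → <-irrefl (sym (trans (sym (section-inj (index<size r) j<size eq)) i≡0)) 1≤j) ,
      (λ _ → return refl)

    sent-exists : ∀ {v} → Generated v → ¬¬ (Σ[ r ∈ W G ] v ↦ r)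
    sent-exists {v} gen = kind-exists gen >>= λ { (k , v:k) → choose (κ k) (return (k , v:k , refl)) }
      where
      choose : ∀ l → Above l v → ¬¬ (Σ[ r ∈ W G ] v ↦ r)
      choose l above = ¬¬-excluded-middle {A = Σ[ j ∈ ℕ ] 1 ≤ j × j < size l × ¬¬ (v ≡ section l j)} >>= λ
        { (yes (j , 1≤j , j<size , v≡)) → return (point l j , sent-point j<size
            (above , (λ j≡0 → ⊥-elim (<-irrefl (sym j≡0) 1≤j)) , (λ _ → v≡)))
        ; (no none) → return (point l 0 , sent-point (above-inhabited above)
            (above , (λ _ j 1≤j j<size eq → none (j , 1≤j , j<size , return eq)) , (λ 0≢0 → ⊥-elim (0≢0 refl)))) }

    sent-functional : ∀ {v r r′} → v ↦ r → v ↦ r′ → r ≡ r′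
    sent-functional {v} {r} {r′} (above , at0 , at-i) (above′ , at0′ , at-i′) =
      decidable-stable (r ≟ᵂ r′) (cases (index r ≟ 0) (index r′ ≟ 0))
      where
      k≡ : kind r ≡ kind r′
      k≡ = above-unique above above′
      index<size′ : ∀ {r₁} r₂ → kind r₁ ≡ kind r₂ → index r₂ < size (kind r₁)
      index<size′ r₂ eq = subst (λ l → index r₂ < size l) (sym eq) (index<size r₂)
      positive : ∀ {i} → i ≢ 0 → 1 ≤ i
      positive {zero} i≢0 = ⊥-elim (i≢0 refl)
      positive {suc i} _ = s≤s z≤n
      cases : Dec (index r ≡ 0) → Dec (index r′ ≡ 0) → ¬¬ (r ≡ r′)
      cases (yes i≡0) (yes i′≡0) = return (same-point k≡ (trans i≡0 (sym i′≡0)))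
      cases (yes i≡0) (no i′≢0) = at-i′ i′≢0 >>= λ eq →
        ⊥-elim (at0 i≡0 (index r′) (positive i′≢0) (index<size′ r′ k≡) (trans eq (cong (λ l → section l (index r′)) (sym k≡))))
      cases (no i≢0) (yes i′≡0) = at-i i≢0 >>= λ eq →
        ⊥-elim (at0′ i′≡0 (index r) (positive i≢0) (index<size′ r (sym k≡)) (trans eq (cong (λ l → section l (index r)) k≡)))
      cases (no i≢0) (no i′≢0) = at-i i≢0 >>= λ eq → at-i′ i′≢0 >>= λ eq′ →
        return (same-point k≡ (section-inj (index<size′ r (sym k≡)) (index<size r′)
          (trans (cong (λ l → section l (index r)) (sym k≡)) (trans (sym eq) eq′))))

    collapse : Bisimulation F G
    collapse = record { _∼_ = _↦_ ; forth = forth ; back = back }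
      where
      forth : ∀ {v r v′} → v ↦ r → R F v v′ → ¬¬ (Σ[ r′ ∈ W G ] R G r r′ × v′ ↦ r′)
      forth v↦r vv′ = sent-exists (Generated-closed (above-generated (proj₁ v↦r)) vv′) >>= λ
        { (r′ , v′↦r′) → return (r′ , ⇝⇒rel (above-⇝ (proj₁ v↦r) (proj₁ v′↦r′) vv′) , v′↦r′) }
      back : ∀ {v r r′} → v ↦ r → R G r r′ → ¬¬ (Σ[ v′ ∈ W F ] R F v v′ × v′ ↦ r′)
      back {r′ = r′} v↦r rr′ = proj₁ v↦r >>= λ { (k , v:k , κk≡) →
        ⇝⇒R k (kind r′) v:k (section-kind (index<size r′))
          (κ-⇝-back (≤-<-trans z≤n (index<size r′)) (subst (_⇝ kind r′) (sym κk≡) (rel⇒⇝ rr′))) >>= λ vv′ →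
        return (_ , vv′ , section-sent r′) }

  collapse-validity : ∀ φ → F ⊨ₘ φ → G ⊨ₘ φ
  collapse-validity = ⊨ₘ-transfer collapse (λ v↦r v↦r′ → return (sent-functional v↦r v↦r′))
    (λ r → return (_ , section-sent r))

module _ {F : Frame} {V : ℕ → W F → Set} {w : W F} where

  ⇒ₘ-intro : ∀ φ ψ → (⟦ φ ⟧ₘ F V w → ⟦ ψ ⟧ₘ F V w) → ⟦ φ ⇒ₘ ψ ⟧ₘ F V w
  ⇒ₘ-intro φ ψ f k = k (inj₁ (λ t → k (inj₂ (f t))))

  ⇒ₘ-elim : ∀ φ ψ → ⟦ φ ⇒ₘ ψ ⟧ₘ F V w → ⟦ φ ⟧ₘ F V w → ⟦ ψ ⟧ₘ F V w
  ⇒ₘ-elim φ ψ h t = ⟦⟧ₘ-stable ψ F V w (λ ¬t′ → h λ { (inj₁ ¬t) → ¬t t ; (inj₂ t′) → ¬t′ t′ })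

_≟ₘ_ : DecidableEquality MF
var p ≟ₘ var p′ with p ≟ p′
... | yes refl = yes refl
... | no p≢p′ = no λ { refl → p≢p′ refl }
⊥ₘ ≟ₘ ⊥ₘ = yes refl
(¬ₘ φ) ≟ₘ (¬ₘ φ′) with φ ≟ₘ φ′
... | yes refl = yes refl
... | no φ≢φ′ = no λ { refl → φ≢φ′ refl }
(φ ∨ₘ ψ) ≟ₘ (φ′ ∨ₘ ψ′) with φ ≟ₘ φ′ | ψ ≟ₘ ψ′
... | yes refl | yes refl = yes refl
... | no φ≢φ′ | _ = no λ { refl → φ≢φ′ refl }
... | _ | no ψ≢ψ′ = no λ { refl → ψ≢ψ′ refl }
(□ φ) ≟ₘ (□ φ′) with φ ≟ₘ φ′
... | yes refl = yes refl
... | no φ≢φ′ = no λ { refl → φ≢φ′ refl }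
var _ ≟ₘ ⊥ₘ = no λ ()
var _ ≟ₘ (¬ₘ _) = no λ ()
var _ ≟ₘ (_ ∨ₘ _) = no λ ()
var _ ≟ₘ (□ _) = no λ ()
⊥ₘ ≟ₘ var _ = no λ ()
⊥ₘ ≟ₘ (¬ₘ _) = no λ ()
⊥ₘ ≟ₘ (_ ∨ₘ _) = no λ ()
⊥ₘ ≟ₘ (□ _) = no λ ()
(¬ₘ _) ≟ₘ var _ = no λ ()
(¬ₘ _) ≟ₘ ⊥ₘ = no λ ()
(¬ₘ _) ≟ₘ (_ ∨ₘ _) = no λ ()
(¬ₘ _) ≟ₘ (□ _) = no λ ()
(_ ∨ₘ _) ≟ₘ var _ = no λ ()
(_ ∨ₘ _) ≟ₘ ⊥ₘ = no λ ()
(_ ∨ₘ _) ≟ₘ (¬ₘ _) = no λ ()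
(_ ∨ₘ _) ≟ₘ (□ _) = no λ ()
(□ _) ≟ₘ var _ = no λ ()
(□ _) ≟ₘ ⊥ₘ = no λ ()
(□ _) ≟ₘ (¬ₘ _) = no λ ()
(□ _) ≟ₘ (_ ∨ₘ _) = no λ ()

atoms : MF → List MF
atoms (var p) = var p ∷ []
atoms ⊥ₘ = []
atoms (¬ₘ φ) = atoms φ
atoms (φ ∨ₘ ψ) = atoms φ ++ atoms ψ
atoms (□ φ) = □ φ ∷ []

module _ (F : Frame) (V : ℕ → W F → Set) (w : W F) where

  Faithful : (MF → Bool) → MF → Set
  Faithful v φ = (v φ ≡ true) ⇔ ⟦ φ ⟧ₘ F V w

  evalB-faithful : ∀ v φ → All (Faithful v) (atoms φ) → (evalB v φ ≡ true) ⇔ ⟦ φ ⟧ₘ F V w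
  evalB-faithful v (var p) (faithful ∷ []) = faithful
  evalB-faithful v ⊥ₘ _ = mk⇔ (λ ()) ⊥-elim
  evalB-faithful v (¬ₘ φ) faithful with evalB v φ | evalB-faithful v φ faithful
  ... | true | ih = mk⇔ (λ ()) (λ ¬t → ⊥-elim (¬t (to ih refl)))
  ... | false | ih = mk⇔ (λ _ t → false≢true (from ih t)) (λ _ → refl)
    where
    false≢true : false ≢ true
    false≢true ()
  evalB-faithful v (φ ∨ₘ ψ) faithful
    with evalB v φ | evalB v ψ
       | evalB-faithful v φ (proj₁ (++⁻ (atoms φ) faithful)) | evalB-faithful v ψ (proj₂ (++⁻ (atoms φ) faithful))
  ... | true | _ | ihφ | _ = mk⇔ (λ _ k → k (inj₁ (to ihφ refl))) (λ _ → refl)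
  ... | false | true | _ | ihψ = mk⇔ (λ _ k → k (inj₂ (to ihψ refl))) (λ _ → refl)
  ... | false | false | ihφ | ihψ = mk⇔ (λ ())
    (λ h → ⊥-elim (h λ { (inj₁ t) → false≢true (from ihφ t) ; (inj₂ t) → false≢true (from ihψ t) }))
    where
    false≢true : false ≢ true
    false≢true ()
  evalB-faithful v (□ φ) (faithful ∷ []) = faithful

  faithful-valuation : (φs : List MF) → ¬¬ (Σ[ v ∈ (MF → Bool) ] All (Faithful v) φs)
  faithful-valuation [] = return ((λ _ → true) , [])
  faithful-valuation (φ ∷ φs) = faithful-valuation φs >>= λ { (v , faithful) →
    ¬¬-excluded-middle {A = ⟦ φ ⟧ₘ F V w} >>= λ
      { (yes t) → return (set v φ true , set-faithful v φ true (mk⇔ (λ _ → t) (λ _ → refl)) faithful)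
      ; (no ¬t) → return (set v φ false , set-faithful v φ false (mk⇔ (λ ()) (λ t → ⊥-elim (¬t t))) faithful) } }
    where
    set : (MF → Bool) → MF → Bool → MF → Bool
    set v φ b ψ with ψ ≟ₘ φ
    ... | yes _ = b
    ... | no _ = v ψ
    set-other : ∀ v φ b ψ → ψ ≢ φ → set v φ b ψ ≡ v ψ
    set-other v φ b ψ ψ≢φ with ψ ≟ₘ φ
    ... | yes ψ≡φ = ⊥-elim (ψ≢φ ψ≡φ)
    ... | no _ = refl
    set-faithful : ∀ v φ b {φs} → (b ≡ true) ⇔ ⟦ φ ⟧ₘ F V w → All (Faithful v) φs → All (Faithful (set v φ b)) (φ ∷ φs)
    set-faithful v φ b {φs} φ-faithful faithful = here-faithful ∷ rest φs faithful
      where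
      here-faithful : Faithful (set v φ b) φ
      here-faithful with φ ≟ₘ φ
      ... | yes _ = φ-faithful
      ... | no φ≢φ = ⊥-elim (φ≢φ refl)
      rest : ∀ ψs → All (Faithful v) ψs → All (Faithful (set v φ b)) ψs
      rest [] [] = []
      rest (ψ ∷ ψs) (ψ-faithful ∷ faithful) with ψ ≟ₘ φ
      ... | yes refl = here-faithful ∷ rest ψs faithful
      ... | no ψ≢φ = subst (λ t → (t ≡ true) ⇔ ⟦ ψ ⟧ₘ F V w) (sym (set-other v φ b ψ ψ≢φ)) ψ-faithful
                     ∷ rest ψs faithful

taut-valid : ∀ F φ → Taut φ → F ⊨ₘ φ
taut-valid F φ tautology V w = ¬¬-rec (⟦⟧ₘ-stable φ F V w) (faithful-valuation F V w (atoms φ))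
  λ { (v , faithful) → to (evalB-faithful F V w v φ faithful) (tautology v) }

substitution-lemma : ∀ φ (σ : ℕ → MF) F V w → ⟦ φ [ σ ]ₘ ⟧ₘ F V w ⇔ ⟦ φ ⟧ₘ F (λ p u → ⟦ σ p ⟧ₘ F V u) w
substitution-lemma (var p) σ F V w = mk⇔ return (⟦⟧ₘ-stable (σ p) F V w)
substitution-lemma ⊥ₘ σ F V w = mk⇔ id id
substitution-lemma (¬ₘ φ) σ F V w = ¬-cong (substitution-lemma φ σ F V w)
substitution-lemma (φ ∨ₘ ψ) σ F V w = ¬¬⊎-cong (substitution-lemma φ σ F V w) (substitution-lemma ψ σ F V w)
substitution-lemma (□ φ) σ F V w = mk⇔
  (λ h v r → to (substitution-lemma φ σ F V v) (h v r))
  (λ h v r → from (substitution-lemma φ σ F V v) (h v r))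

K5⊕-sound : ∀ φ F → Euclidean F → F ⊨ₘ φ → ∀ ψ → K5⊕ φ ψ → F ⊨ₘ ψ
K5⊕-sound φ F euc F⊨φ _ (taut ψ t) = taut-valid F ψ t
K5⊕-sound φ F euc F⊨φ _ (axK ψ χ) V w =
  ⇒ₘ-intro (□ (ψ ⇒ₘ χ)) ((□ ψ) ⇒ₘ (□ χ)) λ h₁ →
  ⇒ₘ-intro (□ ψ) (□ χ) λ h₂ v r → ⇒ₘ-elim ψ χ (h₁ v r) (h₂ v r)
K5⊕-sound φ F euc F⊨φ _ (ax5 ψ) V w =
  ⇒ₘ-intro (◇ ψ) (□ (◇ ψ)) λ h v wv none → h λ u wu t → Euclidean.euclid euc wv wu λ vu → none u vu t
K5⊕-sound φ F euc F⊨φ _ axφ = F⊨φ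
K5⊕-sound φ F euc F⊨φ _ (usub ψ σ d) V w = from (substitution-lemma ψ σ F V w) (K5⊕-sound φ F euc F⊨φ ψ d _ w)
K5⊕-sound φ F euc F⊨φ χ (mp ψ _ d₁ d₂) V w =
  ⇒ₘ-elim ψ χ (K5⊕-sound φ F euc F⊨φ _ d₁ V w) (K5⊕-sound φ F euc F⊨φ ψ d₂ V w)
K5⊕-sound φ F euc F⊨φ _ (nec ψ d) V w v _ = K5⊕-sound φ F euc F⊨φ ψ d V v

-- Instantiate axiom 5 with the valuation true only at v′.
Fr-euclidean : ∀ L → IsEuclideanLogic L → ∀ F → Fr L F → Euclidean F
Fr-euclidean L L-euclidean F F∈Fr = euclidean λ {u} {v} {v′} uv uv′ ¬vv′ →
  let V : ℕ → W F → Set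
      V _ t = t ≡ v′
  in ⇒ₘ-elim {F} {V} {u} (◇ (var 0)) (□ (◇ (var 0))) (F∈Fr _ (IsEuclideanLogic.ax5 L-euclidean (var 0)) V u)
       (λ none → none v′ uv′ (λ k → k refl)) v uv (λ t vt h → h (λ eq → ¬vv′ (subst (R F v) eq vt)))

flower-euclidean : ∀ m 1≤m n → Euclidean (Flower m 1≤m n)
flower-euclidean m 1≤m minus1 = euclidean λ _ _ → return tt
flower-euclidean m 1≤m (nat n) = euclidean λ {u} {v} {v′} uv uv′ → return (inj₂ (in-cluster v {u} uv , in-cluster v′ {u} uv′))
  where
  in-cluster : ∀ (t : W (Flower m 1≤m (nat n))) {s} → R (Flower m 1≤m (nat n)) s t → 1 ≤ proj₁ t
  in-cluster t (inj₁ (_ , 1≤t , _)) = 1≤t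
  in-cluster t (inj₂ (_ , 1≤t)) = 1≤t

coincidence : ∀ B F (ρ ρ′ : ℕ → W F) → (∀ z → FreeIn z B → ρ z ≡ ρ′ z) → ⟦ B ⟧f F ρ → ⟦ B ⟧f F ρ′
coincidence (Rf y z) F ρ ρ′ agree = ¬¬-map (subst₂ (R F) (agree y rl) (agree z rr))
coincidence (y ≐ z) F ρ ρ′ agree = ¬¬-map λ eq → trans (sym (agree y el)) (trans eq (agree z er))
coincidence (¬f B) F ρ ρ′ agree = contraposition (coincidence B F ρ′ ρ λ z free → sym (agree z (ng free)))
coincidence (B ∨f C) F ρ ρ′ agree = ¬¬-map (Sum.map
  (coincidence B F ρ ρ′ λ z free → agree z (ol free)) (coincidence C F ρ ρ′ λ z free → agree z (or free)))
coincidence (∀f y B) F ρ ρ′ agree h d = coincidence B F (ρ [ y ↦ d ]) (ρ′ [ y ↦ d ]) agree′ (h d)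
  where
  agree′ : ∀ z → FreeIn z B → (ρ [ y ↦ d ]) z ≡ (ρ′ [ y ↦ d ]) z
  agree′ z free with z ≟ y
  ... | yes refl = trans (update-same ρ z d) (sym (update-same ρ′ z d))
  ... | no z≢y = trans (update-other ρ d (z≢y ∘ sym))
    (trans (agree z (al z≢y free)) (sym (update-other ρ′ d (z≢y ∘ sym))))

sentence-env-irrelevant : ∀ A F (ρ ρ′ : ℕ → W F) → Sentence A → ⟦ A ⟧f F ρ → ⟦ A ⟧f F ρ′
sentence-env-irrelevant A F ρ ρ′ closed = coincidence A F ρ ρ′ λ z free → ⊥-elim (closed z free)

module GeneratedSubframe (F : Frame) (euc : Euclidean F) (w : W F) where
  open Rooted F euc w

  -- Membership is kept irrelevant so that points are equal as soon as they are equal in F.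
  F↾w : Frame
  F↾w = record
    { W = Σ[ v ∈ W F ] Irrelevant (Generated v)
    ; R = λ v v′ → R F (proj₁ v) (proj₁ v′)
    ; pt = (w , [ return (inj₁ refl) ]) }

  root↾ : W F↾w
  root↾ = pt F↾w

  ↾-≡ : ∀ {v v′ : W F↾w} → proj₁ v ≡ proj₁ v′ → v ≡ v′
  ↾-≡ refl = refl

  inclusion : Bisimulation F F↾w
  inclusion = record
    { _∼_ = λ v v′ → v ≡ proj₁ v′
    ; forth = λ { {_} {_ , [ gen ]} {v′} refl vv′ →
        return ((v′ , [ Generated-closed (¬-recompute gen) vv′ ]) , vv′ , refl) }
    ; back = λ { refl vv′ → return (_ , vv′ , refl) } }

  ↾-validity : ∀ φ → F ⊨ₘ φ → F↾w ⊨ₘ φ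
  ↾-validity = ⊨ₘ-transfer inclusion (λ { refl refl → return refl }) (λ v → return (proj₁ v , refl))

  ↾-truth-at-root : ∀ φ (V : ℕ → W F → Set) → F↾w ⊨ₘ φ → ⟦ φ ⟧ₘ F V w
  ↾-truth-at-root φ V F↾w⊨φ =
    from (bisimulation-truth inclusion V (λ p v → V p (proj₁ v)) (λ { p refl → mk⇔ id id }) φ refl)
      (F↾w⊨φ _ root↾)

  τ-generated : (x : ℕ) → ∀ B (σ : ℕ → W F↾w) (ρ : ℕ → W F) → (∀ z → FreeIn z B → ρ z ≡ proj₁ (σ z)) →
    ρ x ≡ w → ¬ OccursIn x B → ⟦ B ⟧f F↾w σ ⇔ ⟦ τ x B ⟧f F ρ
  τ-generated x (Rf y z) σ ρ agree _ _ = mk⇔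
    (¬¬-map (subst₂ (R F) (sym (agree y rl)) (sym (agree z rr))))
    (¬¬-map (subst₂ (R F) (agree y rl) (agree z rr)))
  τ-generated x (y ≐ z) σ ρ agree _ _ = mk⇔
    (¬¬-map λ eq → trans (agree y el) (trans (cong proj₁ eq) (sym (agree z er))))
    (¬¬-map λ eq → ↾-≡ (trans (sym (agree y el)) (trans eq (agree z er))))
  τ-generated x (¬f B) σ ρ agree ρx≡w x∉ =
    ¬-cong (τ-generated x B σ ρ (λ z free → agree z (ng free)) ρx≡w (x∉ ∘ ng))
  τ-generated x (B ∨f C) σ ρ agree ρx≡w x∉ = ¬¬⊎-cong
    (τ-generated x B σ ρ (λ z free → agree z (ol free)) ρx≡w (x∉ ∘ ol))
    (τ-generated x C σ ρ (λ z free → agree z (or free)) ρx≡w (x∉ ∘ or))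
  τ-generated x (∀f y B) σ ρ agree ρx≡w x∉ = mk⇔ forth back
    where
    y≢x : y ≢ x
    y≢x refl = x∉ ab
    agree′ : ∀ d v → d ≡ proj₁ v → ∀ z → FreeIn z B → (ρ [ y ↦ d ]) z ≡ proj₁ ((σ [ y ↦ v ]) z)
    agree′ d v d≡ z free with z ≟ y
    ... | yes refl = trans (update-same ρ z d) (trans d≡ (cong proj₁ (sym (update-same σ z v))))
    ... | no z≢y = trans (update-other ρ d (z≢y ∘ sym))
      (trans (agree z (al z≢y free)) (cong proj₁ (sym (update-other σ v (z≢y ∘ sym)))))
    IH : ∀ d gen → ⟦ B ⟧f F↾w (σ [ y ↦ (d , gen) ]) ⇔ ⟦ τ x B ⟧f F (ρ [ y ↦ d ])
    IH d gen = τ-generated x B (σ [ y ↦ (d , gen) ]) (ρ [ y ↦ d ]) (agree′ d (d , gen) refl)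
      (trans (update-other ρ d y≢x) ρx≡w) (x∉ ∘ al)
    guarded : ∀ d → ⟦ guard x y ⟧f F (ρ [ y ↦ d ]) ⇔ Generated d
    guarded = guard-sem F euc w x y ρ ρx≡w y≢x
    forth : ⟦ ∀f y B ⟧f F↾w σ → ⟦ τ x (∀f y B) ⟧f F ρ
    forth h d = ¬¬-excluded-middle {A = Generated d} >>= λ
      { (no ¬gen) → return (inj₁ (¬gen ∘ to (guarded d)))
      ; (yes gen) → return (inj₂ (to (IH d [ gen ]) (h (d , [ gen ])))) }
    back : ⟦ τ x (∀f y B) ⟧f F ρ → ⟦ ∀f y B ⟧f F↾w σ
    back h (d , [ gen ]) = ¬¬-rec (⟦⟧f-stable B F↾w _) (h d) λ
      { (inj₁ unguarded) → ⊥-elim (unguarded (from (guarded d) (¬-recompute gen)))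
      ; (inj₂ t) → from (IH d [ gen ]) t }

  τ-generated-sentence : (x : ℕ) → ∀ A → Sentence A → ¬ OccursIn x A → ∀ ρ → ρ x ≡ w →
    F↾w ⊨f A ⇔ ⟦ τ x A ⟧f F ρ
  τ-generated-sentence x A closed x∉ ρ ρx≡w = mk⇔
    (λ h → to (agree (λ _ → root↾)) (h _))
    (λ h σ → from (agree σ) h)
    where
    agree : ∀ σ → ⟦ A ⟧f F↾w σ ⇔ ⟦ τ x A ⟧f F ρ
    agree σ = τ-generated x A σ ρ (λ z free → ⊥-elim (closed z free)) ρx≡w x∉

-- Characteristic formulas of shapes

infixr 6 _∧ₘ_

_∧ₘ_ : MF → MF → MF
φ ∧ₘ ψ = ¬ₘ ((¬ₘ φ) ∨ₘ (¬ₘ ψ))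

⊤ₘ : MF
⊤ₘ = ¬ₘ ⊥ₘ

⋀ : ℕ → (ℕ → MF) → MF
⋀ zero φ = ⊤ₘ
⋀ (suc n) φ = ⋀ n φ ∧ₘ φ n

module Connectives (F : Frame) (V : ℕ → W F → Set) where

  ∧ₘ-sem : ∀ φ ψ w → ⟦ φ ∧ₘ ψ ⟧ₘ F V w ⇔ (⟦ φ ⟧ₘ F V w × ⟦ ψ ⟧ₘ F V w)
  ∧ₘ-sem φ ψ w = mk⇔
    (λ h → ⟦⟧ₘ-stable φ F V w (λ ¬t → h (λ k → k (inj₁ ¬t))) , ⟦⟧ₘ-stable ψ F V w (λ ¬t → h (λ k → k (inj₂ ¬t))))
    (λ { (t , t′) h → h λ { (inj₁ ¬t) → ¬t t ; (inj₂ ¬t′) → ¬t′ t′ } })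

  ⋀-sem : ∀ n φ w → ⟦ ⋀ n φ ⟧ₘ F V w ⇔ (∀ i → i < n → ⟦ φ i ⟧ₘ F V w)
  ⋀-sem zero φ w = mk⇔ (λ _ i ()) (λ _ ⊥ → ⊥)
  ⋀-sem (suc n) φ w = mk⇔ elim intro
    where
    elim : ⟦ ⋀ (suc n) φ ⟧ₘ F V w → ∀ i → i < suc n → ⟦ φ i ⟧ₘ F V w
    elim h i i<1+n with to (∧ₘ-sem (⋀ n φ) (φ n) w) h | m<1+n⇒m<n∨m≡n i<1+n
    ... | (all , _) | inj₁ i<n = to (⋀-sem n φ w) all i i<n
    ... | (_ , last) | inj₂ refl = last
    intro : (∀ i → i < suc n → ⟦ φ i ⟧ₘ F V w) → ⟦ ⋀ (suc n) φ ⟧ₘ F V w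
    intro h = from (∧ₘ-sem (⋀ n φ) (φ n) w)
      (from (⋀-sem n φ w) (λ i i<n → h i (m<n⇒m<1+n i<n)) , h n ≤-refl)

  ◇-elim : ∀ φ w → ⟦ ◇ φ ⟧ₘ F V w → ¬¬ (Σ[ v ∈ W F ] R F w v × ⟦ φ ⟧ₘ F V v)
  ◇-elim φ w h k = h (λ v wv t → k (v , wv , t))

  ◇-intro : ∀ φ {w} v → R F w v → ⟦ φ ⟧ₘ F V v → ⟦ ◇ φ ⟧ₘ F V w
  ◇-intro φ v wv t none = none v wv t

⋀ₗ : List MF → MF
⋀ₗ [] = ⊤ₘ
⋀ₗ (φ ∷ φs) = φ ∧ₘ ⋀ₗ φs

⋀ₗ-valid : ∀ F φs → F ⊨ₘ ⋀ₗ φs ⇔ (∀ {φ} → φ ∈ φs → F ⊨ₘ φ)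
⋀ₗ-valid F φs = mk⇔ (elim φs) (intro φs)
  where
  elim : ∀ φs → F ⊨ₘ ⋀ₗ φs → ∀ {φ} → φ ∈ φs → F ⊨ₘ φ
  elim (ψ ∷ φs) valid (here refl) V w = proj₁ (to (Connectives.∧ₘ-sem F V ψ (⋀ₗ φs) w) (valid V w))
  elim (ψ ∷ φs) valid (there φ∈) = elim φs (λ V w → proj₂ (to (Connectives.∧ₘ-sem F V ψ (⋀ₗ φs) w) (valid V w))) φ∈
  intro : ∀ φs → (∀ {φ} → φ ∈ φs → F ⊨ₘ φ) → F ⊨ₘ ⋀ₗ φs
  intro [] _ V w = λ ⊥ → ⊥
  intro (ψ ∷ φs) valid V w =
    from (Connectives.∧ₘ-sem F V ψ (⋀ₗ φs) w) (valid (here refl) V w , intro φs (valid ∘ there) V w)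

-- The atoms p_o, p_(o+1), ... are used to mark witnesses; the i-th witness satisfies p_(o+i) and no earlier mark.
mark : ℕ → ℕ → MF
mark o i = var (o + i)

first-mark : ℕ → ℕ → MF
first-mark o i = mark o i ∧ₘ ⋀ i (λ j → ¬ₘ mark o j)

many-seen : ℕ → ℕ → MF
many-seen o c = ⋀ c (λ i → ◇ (first-mark o i))

many-unseen : ℕ → ℕ → MF
many-unseen o n = ⋀ n (λ j → (□ (¬ₘ mark o j)) ∧ₘ ◇ (◇ (first-mark o j)))

-- cluster a and flower a n stand for the flowers F_(a+1)^(-1) and F_(a+1)^n; deadEnd is a single irreflexive point.
data Shape : Set where
  cluster : ℕ → Shape
  flower  : ℕ → ℕ → Shape
  deadEnd : Shape

description : Shape → MF
description (cluster a) = many-seen 1 (suc a)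
description (flower a n) = (var 0 ∧ₘ □ (¬ₘ var 0)) ∧ₘ many-seen 1 (suc a) ∧ₘ many-unseen (2 + a) n
description deadEnd = □ ⊥ₘ

χ : Shape → MF
χ t = ¬ₘ description t

module _ (F : Frame) (w : W F) where
  open PointKinds F w

  AtLeast : Shape → Set
  AtLeast (cluster a) = Distinct (HasKind seen) (suc a)
  AtLeast (flower a n) = ¬ R F w w × Distinct (HasKind seen) (suc a) × Distinct (HasKind unseen) n
  AtLeast deadEnd = ∀ v → ¬ R F w v

  module _ (V : ℕ → W F → Set) where
    open Connectives F V

    Marked : ℕ → ℕ → W F → Set
    Marked o i v = ⟦ mark o i ⟧ₘ F V v × (∀ j → j < i → ¬ ⟦ mark o j ⟧ₘ F V v)

    first-mark-sem : ∀ o i v → ⟦ first-mark o i ⟧ₘ F V v ⇔ Marked o i v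
    first-mark-sem o i v = mk⇔
      (λ h → let (t , earlier) = to (∧ₘ-sem (mark o i) _ v) h in t , to (⋀-sem i _ v) earlier)
      (λ { (t , earlier) → from (∧ₘ-sem (mark o i) _ v) (t , from (⋀-sem i _ v) earlier) })

    marks-distinct : ∀ o c (u : ℕ → W F) → (∀ i → i < c → Marked o i (u i)) → InjectiveBelow c u
    marks-distinct o c u marked {i} {j} i<c j<c eq with <-cmp i j
    ... | tri≈ _ i≡j _ = i≡j
    ... | tri< i<j _ _ = ⊥-elim (proj₂ (marked j j<c) i i<j (subst (⟦ mark o i ⟧ₘ F V) eq (proj₁ (marked i i<c))))
    ... | tri> _ _ j<i = ⊥-elim (proj₂ (marked i i<c) j j<i (subst (⟦ mark o j ⟧ₘ F V) (sym eq) (proj₁ (marked j j<c))))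

    many-seen-distinct : ∀ o c → ⟦ many-seen o c ⟧ₘ F V w → ¬¬ (Distinct (HasKind seen) c)
    many-seen-distinct o c h = finite-choice (λ i v → R F w v × Marked o i v) w c witness >>= λ { (u , chosen) →
      return (u , (λ {i} i<c → return (proj₁ (chosen i i<c))) ,
                  (λ {i} {j} → marks-distinct o c u (λ i i<c → proj₂ (chosen i i<c)) {i} {j})) }
      where
      witness : ∀ i → i < c → ¬¬ (Σ[ v ∈ W F ] R F w v × Marked o i v)
      witness i i<c = ◇-elim (first-mark o i) w (to (⋀-sem c (λ i → ◇ (first-mark o i)) w) h i i<c) >>= λ
        { (v , wv , t) → return (v , wv , to (first-mark-sem o i v) t) }

    many-unseen-distinct : ∀ o n → ⟦ many-unseen o n ⟧ₘ F V w → ¬¬ (Distinct (HasKind unseen) n)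
    many-unseen-distinct o n h = finite-choice (λ j v → HasKind unseen v × Marked o j v) w n witness >>= λ { (e , chosen) →
      return (e , (λ {j} j<n → proj₁ (chosen j j<n)) ,
                  (λ {i} {j} → marks-distinct o n e (λ j j<n → proj₂ (chosen j j<n)) {i} {j})) }
      where
      witness : ∀ j → j < n → ¬¬ (Σ[ v ∈ W F ] HasKind unseen v × Marked o j v)
      witness j j<n =
        let (none-seen , reach) = to (∧ₘ-sem (□ (¬ₘ mark o j)) (◇ (◇ (first-mark o j))) w)
                                     (to (⋀-sem n (λ j → (□ (¬ₘ mark o j)) ∧ₘ ◇ (◇ (first-mark o j))) w) h j j<n)
        in ◇-elim (◇ (first-mark o j)) w reach >>= λ { (u , wu , t) → ◇-elim (first-mark o j) u t >>= λ { (v , uv , t′) →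
           let marked : Marked o j v
               marked = to (first-mark-sem o j v) t′
           in return (v , ((λ wv → none-seen v wv (proj₁ marked)) , return (u , wu , uv)) , marked) } }

    description-atLeast : ∀ t → ⟦ description t ⟧ₘ F V w → ¬¬ (AtLeast t)
    description-atLeast (cluster a) h = many-seen-distinct 1 (suc a) h
    description-atLeast (flower a n) h =
      let (irreflexive , counts) = to (∧ₘ-sem (var 0 ∧ₘ □ (¬ₘ var 0)) (many-seen 1 (suc a) ∧ₘ many-unseen (2 + a) n) w) h
          (p₀ , □¬p₀) = to (∧ₘ-sem (var 0) (□ (¬ₘ var 0)) w) irreflexive
          (seen≥ , unseen≥) = to (∧ₘ-sem (many-seen 1 (suc a)) (many-unseen (2 + a) n) w) counts
      in many-seen-distinct 1 (suc a) seen≥ >>= λ seens → many-unseen-distinct (2 + a) n unseen≥ >>= λ unseens →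
         return ((λ ww → □¬p₀ w ww p₀) , seens , unseens)
    description-atLeast deadEnd h = return h

χ-refuted-atLeast : ∀ F t → ¬ (F ⊨ₘ χ t) → ¬¬ (Σ[ v ∈ W F ] AtLeast F v t)
χ-refuted-atLeast F t ¬valid k = ¬valid λ V v d → description-atLeast F v V t d (λ atLeast → k (v , atLeast))

module Witnesses (F : Frame) (w : W F) (a n : ℕ) (u e : ℕ → W F)
  (u-inj : InjectiveBelow (suc a) u) (e-inj : InjectiveBelow n e) where
  open PointKinds F w

  -- p₀ marks w, p₍₁₊ᵢ₎ marks u i and p₍₂₊ₐ₊ⱼ₎ marks e j.
  V : ℕ → W F → Set
  V k v = (k ≡ 0 × v ≡ w) ⊎ ((1 ≤ k × k ≤ suc a) × v ≡ u (k ∸ 1)) ⊎ (2 + a ≤ k × v ≡ e (k ∸ (2 + a)))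

  open Connectives F V

  u-marked : ∀ {i} → i < suc a → Marked F w V 1 i (u i)
  u-marked {i} i<1+a = return (inj₂ (inj₁ ((s≤s z≤n , i<1+a) , refl))) , λ j j<i marked → marked (not-earlier j<i)
    where
    not-earlier : ∀ {j} → j < i → ¬ V (1 + j) (u i)
    not-earlier j<i (inj₂ (inj₁ (_ , eq))) = <-irrefl (sym (u-inj i<1+a (<-trans j<i i<1+a) eq)) j<i
    not-earlier j<i (inj₂ (inj₂ (2+a≤ , _))) = <-irrefl refl (≤-trans 2+a≤ (<-trans j<i i<1+a))

  e-index : ∀ j → e (2 + a + j ∸ (2 + a)) ≡ e j
  e-index j = cong e (m+n∸m≡n (2 + a) j)

  e-marked : ∀ {j} → j < n → Marked F w V (2 + a) j (e j)
  e-marked {j} j<n = return (inj₂ (inj₂ (m≤m+n (2 + a) j , sym (e-index j)))) , λ i i<j marked → marked (not-earlier i<j)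
    where
    not-earlier : ∀ {i} → i < j → ¬ V (2 + a + i) (e j)
    not-earlier {i} i<j (inj₂ (inj₁ ((_ , ≤1+a) , _))) = <-irrefl refl (≤-trans (s≤s (m≤m+n (suc a) i)) ≤1+a)
    not-earlier {i} i<j (inj₂ (inj₂ (_ , eq))) =
      <-irrefl (sym (e-inj j<n (<-trans i<j j<n) (trans eq (e-index i)))) i<j

  many-seen-holds : (∀ i → i < suc a → HasKind seen (u i)) → ⟦ many-seen 1 (suc a) ⟧ₘ F V w
  many-seen-holds seen-u = from (⋀-sem (suc a) _ w) λ i i<1+a →
    ¬¬-rec (⟦⟧ₘ-stable (◇ (first-mark 1 i)) F V w) (seen-u i i<1+a) λ wu →
    ◇-intro (first-mark 1 i) (u i) wu (from (first-mark-sem F w V 1 i (u i)) (u-marked i<1+a))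

  many-unseen-holds : (∀ j → j < n → HasKind unseen (e j)) → ⟦ many-unseen (2 + a) n ⟧ₘ F V w
  many-unseen-holds unseen-e = from (⋀-sem n (λ j → (□ (¬ₘ mark (2 + a) j)) ∧ₘ ◇ (◇ (first-mark (2 + a) j))) w) λ j j<n →
    from (∧ₘ-sem (□ (¬ₘ mark (2 + a) j)) (◇ (◇ (first-mark (2 + a) j))) w)
      ( (λ v wv marked → marked λ { (inj₂ (inj₁ ((_ , ≤1+a) , _))) → <-irrefl refl (≤-trans (s≤s (m≤m+n (suc a) j)) ≤1+a)
                                  ; (inj₂ (inj₂ (_ , refl))) → proj₁ (unseen-e j j<n) (subst (R F w) (e-index j) wv) })
      , ¬¬-rec (⟦⟧ₘ-stable (◇ (◇ (first-mark (2 + a) j))) F V w) (proj₂ (unseen-e j j<n)) λ { (b , wb , be) →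
          ◇-intro (◇ (first-mark (2 + a) j)) b wb
            (◇-intro (first-mark (2 + a) j) (e j) be (from (first-mark-sem F w V (2 + a) j (e j)) (e-marked j<n))) })

atLeast-refutes-χ : ∀ F w t → AtLeast F w t → ¬ (F ⊨ₘ χ t)
atLeast-refutes-χ F w (cluster a) (u , seen-u , u-inj) valid =
  valid V w (many-seen-holds (λ i i<1+a → seen-u i<1+a))
  where open Witnesses F w a 0 u u u-inj (λ ())
atLeast-refutes-χ F w (flower a n) (¬ww , (u , seen-u , u-inj) , (e , unseen-e , e-inj)) valid =
  valid V w (from (∧ₘ-sem (var 0 ∧ₘ □ (¬ₘ var 0)) (many-seen 1 (suc a) ∧ₘ many-unseen (2 + a) n) w)
    ( from (∧ₘ-sem (var 0) (□ (¬ₘ var 0)) w) (return (inj₁ (refl , refl)) , λ v wv marked → marked (unmarked v wv))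
    , from (∧ₘ-sem (many-seen 1 (suc a)) (many-unseen (2 + a) n) w) (many-seen-holds (λ i i<1+a → seen-u i<1+a) , many-unseen-holds (λ j j<n → unseen-e j<n))))
  where
  open Witnesses F w a n u e u-inj e-inj
  open Connectives F V
  unmarked : ∀ v → R F w v → ¬ V 0 v
  unmarked v wv (inj₁ (_ , refl)) = ¬ww wv
  unmarked v wv (inj₂ (inj₁ ((() , _) , _)))
  unmarked v wv (inj₂ (inj₂ (() , _)))
atLeast-refutes-χ F w deadEnd noSucc valid = valid (λ _ _ → ⊤) w noSucc

model : Shape → Frame
model (cluster a) = Flower (suc a) (s≤s z≤n) minus1
model (flower a n) = Flower (suc a) (s≤s z≤n) (nat n)
model deadEnd = DeadEnd

model-kinded : ∀ t → Kinded (model t)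
model-kinded (cluster a) = ClusterKinds.cluster-kinded (suc a) (s≤s z≤n)
model-kinded (flower a n) = FlowerKinds.flower-kinded (suc a) (s≤s z≤n) n
model-kinded deadEnd = deadEnd-kinded

Bounded : ℕ → Shape → Set
Bounded q (cluster a) = suc a ≤ q
Bounded q (flower a n) = suc a ≤ q × n ≤ q
Bounded q deadEnd = ⊤

-- t ≼ t′: the model of t is a p-morphic image of the model of t′.
_≼_ : Shape → Shape → Set
deadEnd ≼ deadEnd = ⊤
cluster a′ ≼ cluster a = a′ ≤ a
cluster a′ ≼ flower a n = a′ ≤ a
flower a′ n′ ≼ flower a n = a′ ≤ a × n′ ≤ n
_ ≼ _ = ⊥

shapes : ℕ → List Shape
shapes q = deadEnd ∷ map cluster (upTo q) ++ cartesianProductWith flower (upTo q) (upTo (suc q))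

bounded-∈-shapes : ∀ q t → Bounded q t → t ∈ shapes q
bounded-∈-shapes q deadEnd _ = here refl
bounded-∈-shapes q (cluster a) a<q = there (∈-++⁺ˡ (∈-map⁺ cluster (∈-upTo⁺ a<q)))
bounded-∈-shapes q (flower a n) (a<q , n≤q) = there (∈-++⁺ʳ (map cluster (upTo q))
  (Any.cartesianProductWith⁺ flower (cong₂ flower) (∈-upTo⁺ a<q) (∈-upTo⁺ (s≤s n≤q))))

count-empty : ∀ {P : X → Set} {q} (c : Count P q) → 1 ≤ q → Count.size c ≡ 0 → ∀ v → ¬ P v
count-empty c 1≤q size≡0 v Pv = Count.complete c (subst (_< _) (sym size≡0) 1≤q) v Pv
  λ { (i , i<size , _) → n≮0 (subst (_ <_) size≡0 i<size) }

count-nonempty : ∀ {P : X → Set} {q a} (c : Count P q) → Count.size c ≡ suc a → P (Count.elem c 0)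
count-nonempty c size≡ = Count.elem-P c (subst (0 <_) (sym size≡) (s≤s z≤n))

distinct≤size : ∀ {P : X → Set} {q c′} (c : Count P q) → Distinct P c′ → c′ ≤ q → c′ ≤ Count.size c
distinct≤size {q = q} {c′} c (u , Pu , u-inj) c′≤q with Count.size c <? q
... | no size≮q = subst (c′ ≤_) (sym (≤-antisym (Count.size≤q c) (≮⇒≥ size≮q))) c′≤q
... | yes size<q = decidable-stable (c′ ≤? Count.size c) λ c′≰size →
  pigeonhole (Count.elem c) (upTo (Count.size c)) c′ u u-inj (subst (_< c′) (sym (length-upTo _)) (≰⇒> c′≰size))
    λ { (i , i<c′ , fresh) → Count.complete c size<q (u i) (Pu i<c′)
    λ { (j , j<size , eq) → lookup fresh (∈-upTo⁺ j<size) eq } }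

module _ (F : Frame) (euc : Euclidean F) (w : W F) (q : ℕ) where
  open Rooted F euc w

  record ShapeAt : Set where
    field
      shape       : Shape
      counts      : (k : Kind) → Count (HasKind k) q
      same-size   : ∀ k → Kinded.size (model-kinded shape) k ≡ Count.size (counts k)
      bounded     : Bounded q shape

  private
    counts-of : Count (HasKind root) q → Count (HasKind seen) q → Count (HasKind unseen) q → (k : Kind) → Count (HasKind k) q
    counts-of cr cs cu root = cr
    counts-of cr cs cu seen = cs
    counts-of cr cs cu unseen = cu

    module _ (ww : R F w w) (cs : Count (HasKind seen) q) (cu : Count (HasKind unseen) q) where
      no-root : Count (HasKind root) q
      no-root = record { size = 0 ; size≤q = z≤n ; elem = λ _ → w ; elem-P = λ () ; elem-inj = λ ()
                       ; complete = λ _ v v:root → ⊥-elim (proj₂ v:root ww) }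

      reflexive-shape : 1 ≤ q → ∀ s → Count.size cs ≡ s → ∀ u → Count.size cu ≡ u → ShapeAt
      reflexive-shape 1≤q zero s≡ _ _ = ⊥-elim (count-empty cs 1≤q s≡ w (return ww))
      reflexive-shape 1≤q (suc a) s≡ (suc _) u≡ = ⊥-elim (proj₂ (count-nonempty cu u≡)
        λ { (v , wv , v-u) → euclid wv ww λ vw → euclid vw v-u λ w-u → proj₁ (count-nonempty cu u≡) w-u })
      reflexive-shape 1≤q (suc a) s≡ zero u≡ = record
        { shape = cluster a ; counts = counts-of no-root cs cu
        ; same-size = λ { root → refl ; seen → sym s≡ ; unseen → sym u≡ }
        ; bounded = subst (_≤ q) s≡ (Count.size≤q cs) }

    module _ (¬ww : ¬ R F w w) (cs : Count (HasKind seen) q) (cu : Count (HasKind unseen) q) (1≤q : 1 ≤ q) where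
      the-root : Count (HasKind root) q
      the-root = record
        { size = 1 ; size≤q = 1≤q ; elem = λ _ → w ; elem-P = λ { (s≤s z≤n) → return refl , ¬ww }
        ; elem-inj = λ { (s≤s z≤n) (s≤s z≤n) _ → refl }
        ; complete = λ _ v v:root → proj₁ v:root >>= λ v≡w → return (0 , s≤s z≤n , v≡w) }

      irreflexive-shape : ∀ s → Count.size cs ≡ s → ∀ u → Count.size cu ≡ u → ShapeAt
      irreflexive-shape zero s≡ zero u≡ = record
        { shape = deadEnd ; counts = counts-of the-root cs cu
        ; same-size = λ { root → refl ; seen → sym s≡ ; unseen → sym u≡ } ; bounded = tt }
      irreflexive-shape zero s≡ (suc _) u≡ = ⊥-elim (proj₂ (count-nonempty cu u≡)
        λ { (v , wv , _) → count-empty cs 1≤q s≡ v (return wv) })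
      irreflexive-shape (suc a) s≡ u u≡ = record
        { shape = flower a u ; counts = counts-of the-root cs cu
        ; same-size = λ { root → refl ; seen → sym s≡ ; unseen → sym u≡ }
        ; bounded = subst (_≤ q) s≡ (Count.size≤q cs) , subst (_≤ q) u≡ (Count.size≤q cu) }

  shape-exists : 1 ≤ q → ¬¬ ShapeAt
  shape-exists 1≤q =
    count (HasKind seen) w q >>= λ cs → count (HasKind unseen) w q >>= λ cu →
    ¬¬-excluded-middle {A = R F w w} >>= λ
      { (yes ww) → return (reflexive-shape ww cs cu 1≤q (Count.size cs) refl (Count.size cu) refl)
      ; (no ¬ww) → return (irreflexive-shape ¬ww cs cu 1≤q (Count.size cs) refl (Count.size cu) refl) }

module ShapeFacts {F : Frame} {euc : Euclidean F} {w : W F} {q : ℕ} (1≤q : 1 ≤ q) (S : ShapeAt F euc w q) where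
  open Rooted F euc w
  open ShapeAt S
  open RootedTranslation F euc w q counts (model shape) (model-kinded shape) same-size
  open Kinded (model-kinded shape) using (size)

  shape-collapse : ∀ φ → F ⊨ₘ φ → model shape ⊨ₘ φ
  shape-collapse = collapse-validity {euc = euc} {w = w} {K = model-kinded shape} record
    { κ = λ k → k ; κ-⇝ = λ k⇝l → k⇝l ; κ-⇝-back = λ _ k⇝l → k⇝l ; κ-fixed = λ _ → refl
    ; κ-inhabited = inhabited ; section = elem ; section-kind = elem-kind ; section-inj = elem-inj }
    where
    inhabited : ∀ {k v} → HasKind k v → 0 < size k
    inhabited {k} {v} v:k with size k in size≡
    ... | zero = ⊥-elim (count-empty (counts k) 1≤q (trans (sym (same-size k)) size≡) v v:k)
    ... | suc _ = s≤s z≤n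

  private
    distinct-of : ∀ k c → size k ≡ c → Distinct (HasKind k) c
    distinct-of k c refl = elem k , elem-kind , elem-inj

    nonempty : ∀ k {a} → size k ≡ suc a → HasKind k (elem k 0)
    nonempty k size≡ = elem-kind (subst (0 <_) (sym size≡) (s≤s z≤n))

    empty : ∀ k → size k ≡ 0 → ∀ v → ¬ HasKind k v
    empty k size≡ = count-empty (counts k) 1≤q (trans (sym (same-size k)) size≡)

    atLeast-of : ∀ t → (∀ k → Kinded.size (model-kinded t) k ≡ size k) → AtLeast F w t
    atLeast-of (cluster a) sizes = distinct-of seen (suc a) (sym (sizes seen))
    atLeast-of (flower a n) sizes =
      proj₂ (nonempty root (sym (sizes root))) , distinct-of seen (suc a) (sym (sizes seen)) , distinct-of unseen n (sym (sizes unseen))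
    atLeast-of deadEnd sizes v wv = empty seen (sym (sizes seen)) v (return wv)

    bound-by : ∀ k c′ → Distinct (HasKind k) c′ → c′ ≤ q → c′ ≤ size k
    bound-by k c′ d c′≤q = subst (c′ ≤_) (sym (same-size k)) (distinct≤size (counts k) d c′≤q)

    below : ∀ t′ t → (∀ k → Kinded.size (model-kinded t) k ≡ size k) → AtLeast F w t′ → Bounded q t′ → t′ ≼ t
    below deadEnd deadEnd _ _ _ = tt
    below deadEnd (cluster a) sizes noSucc _ = ⊥-elim (nonempty seen (sym (sizes seen)) (noSucc _))
    below deadEnd (flower a n) sizes noSucc _ = ⊥-elim (nonempty seen (sym (sizes seen)) (noSucc _))
    below (cluster a′) (cluster a) sizes d b = ≤-pred (subst (suc a′ ≤_) (sym (sizes seen)) (bound-by seen (suc a′) d b))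
    below (cluster a′) (flower a n) sizes d b = ≤-pred (subst (suc a′ ≤_) (sym (sizes seen)) (bound-by seen (suc a′) d b))
    below (cluster a′) deadEnd sizes (_ , seen₀ , _) _ = ⊥-elim (empty seen (sym (sizes seen)) _ (seen₀ (s≤s z≤n)))
    below (flower a′ n′) (flower a n) sizes (_ , ds , du) (bs , bu) =
      ≤-pred (subst (suc a′ ≤_) (sym (sizes seen)) (bound-by seen (suc a′) ds bs)) ,
      subst (n′ ≤_) (sym (sizes unseen)) (bound-by unseen n′ du bu)
    below (flower a′ n′) deadEnd sizes (_ , (_ , seen₀ , _) , _) _ = ⊥-elim (empty seen (sym (sizes seen)) _ (seen₀ (s≤s z≤n)))
    below (flower a′ n′) (cluster a) sizes (¬ww , _) _ = ⊥-elim (empty root (sym (sizes root)) w (return refl , ¬ww))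

  shape-atLeast : AtLeast F w shape
  shape-atLeast = atLeast-of shape (λ _ → refl)

  atLeast-≼ : ∀ t → AtLeast F w t → Bounded q t → t ≼ shape
  atLeast-≼ t = below t shape (λ _ → refl)

  τ-shape : ∀ x A → Sentence A → ¬ OccursIn x A → qd A ≤ q → ∀ ρ → ρ x ≡ w → ⟦ τ x A ⟧f F ρ ⇔ model shape ⊨f A
  τ-shape = τ-agreement-sentence

-- P-morphisms between flowers

module _ {F : Frame} (euc : Euclidean F) (w : W F) (K : Kinded F)
         (kinds-from-w : ∀ v → PointKinds.HasKind F w (Kinded.kind K v) v)
         {G : Frame} (K′ : Kinded G) (κ : Kind → Kind) where
  open Rooted F euc w
  open Kinded K
  private
    size′ : Kind → ℕ
    size′ = Kinded.size K′

  kinded-collapse :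
    (∀ {k l} → k ⇝ l → κ k ⇝ κ l) →
    (∀ {k l} → 0 < size′ l → κ k ⇝ l → k ⇝ l) →
    (∀ {l} → 0 < size′ l → κ l ≡ l) →
    (∀ {k} → 0 < size k → 0 < size′ (κ k)) →
    (∀ {l} → 0 < size′ l → size′ l ≤ size l) →
    ∀ φ → F ⊨ₘ φ → G ⊨ₘ φ
  kinded-collapse κ-⇝ κ-⇝-back κ-fixed κ-inhabited size′≤size =
    collapse-validity {euc = euc} {w = w} {K = K′} record
      { κ = κ ; κ-⇝ = κ-⇝ ; κ-⇝-back = κ-⇝-back ; κ-fixed = κ-fixed
      ; κ-inhabited = λ {k} {v} v:k → κ-inhabited (subst (λ l → 0 < size l) (kind-unique _ _ (kinds-from-w v) v:k)
                                                    (≤-<-trans z≤n (index<size v)))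
      ; section = point
      ; section-kind = λ {l} i<size′ → subst (λ k → HasKind k (point l _)) (point-kind (within i<size′))
                                         (kinds-from-w (point l _))
      ; section-inj = λ i<size′ j<size′ → point-inj (within i<size′) (within j<size′) }
    where
    within : ∀ {l i} → i < size′ l → i < size l
    within i<size′ = <-≤-trans i<size′ (size′≤size (≤-<-trans z≤n i<size′))

module _ {G : Frame} (euc : Euclidean G) (K : Kinded G) (g : W G) where
  open Kinded K
  open Rooted G euc g

  private
    root-index : ∀ {r} → size root ≡ 1 → kind r ≡ root → index r ≡ 0
    root-index {r} one-root r:root =
      n<1⇒n≡0 (subst (index r <_) one-root (subst (λ k → index r < size k) r:root (index<size r)))

  kinds-from-root : kind g ≡ root → size root ≡ 1 → 0 < size seen → ∀ r → HasKind (kind r) r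
  kinds-from-root g:root one-root some-seen r with kind r in r:k
  ... | root = return (same-point (trans r:k (sym g:root)) (trans (root-index one-root r:k) (sym (root-index one-root g:root)))) ,
               λ gg → subst₂ _⇝_ g:root g:root (rel⇒⇝ gg)
  ... | seen = return (⇝⇒rel (subst₂ _⇝_ (sym g:root) (sym r:k) tt))
  ... | unseen = (λ gr → subst₂ _⇝_ g:root r:k (rel⇒⇝ gr)) ,
      return (point seen 0 , ⇝⇒rel (subst₂ _⇝_ (sym g:root) (sym (point-kind some-seen)) tt) ,
              ⇝⇒rel (subst₂ _⇝_ (sym (point-kind some-seen)) (sym r:k) tt))

private
  flower-kinds-from-root : ∀ m 1≤m n → let open FlowerKinds m 1≤m n in
    ∀ v → PointKinds.HasKind G (0 , z≤n) (Kinded.kind flower-kinded v) v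
  flower-kinds-from-root m 1≤m n =
    kinds-from-root (flower-euclidean m 1≤m (nat n)) (FlowerKinds.flower-kinded m 1≤m n) (0 , z≤n) refl refl 1≤m

  seen-only : Kind → Kind
  seen-only _ = seen

  unseen-to-seen : Kind → Kind
  unseen-to-seen unseen = seen
  unseen-to-seen k = k

  ⇝-seen : ∀ k → k ⇝ seen
  ⇝-seen root = tt
  ⇝-seen seen = tt
  ⇝-seen unseen = tt

flower-validity : ∀ m m′ (1≤m : 1 ≤ m) (1≤m′ : 1 ≤ m′) n n′ → m′ ≤ m → n′ ≤⁻ n →
  ∀ φ → Flower m 1≤m n ⊨ₘ φ → Flower m′ 1≤m′ n′ ⊨ₘ φ
flower-validity m m′ 1≤m 1≤m′ minus1 minus1 m′≤m _ =
  kinded-collapse (flower-euclidean m 1≤m minus1) (1 , ≤-refl , 1≤m) (ClusterKinds.cluster-kinded m 1≤m) (λ _ → return tt)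
    (ClusterKinds.cluster-kinded m′ 1≤m′) (λ k → k)
    (λ k⇝l → k⇝l) (λ _ k⇝l → k⇝l) (λ _ → refl)
    (λ { {seen} _ → 1≤m′ })
    (λ { {seen} _ → m′≤m })
flower-validity m m′ 1≤m 1≤m′ (nat n) minus1 m′≤m _ =
  kinded-collapse (flower-euclidean m 1≤m (nat n)) (0 , z≤n) (FlowerKinds.flower-kinded m 1≤m n) (flower-kinds-from-root m 1≤m n)
    (ClusterKinds.cluster-kinded m′ 1≤m′) seen-only
    (λ _ → tt) (λ { {k} {seen} _ _ → ⇝-seen k }) (λ { {seen} _ → refl })
    (λ _ → 1≤m′)
    (λ { {seen} _ → m′≤m })
flower-validity m m′ 1≤m 1≤m′ (nat n) (nat zero) m′≤m _ =
  kinded-collapse (flower-euclidean m 1≤m (nat n)) (0 , z≤n) (FlowerKinds.flower-kinded m 1≤m n) (flower-kinds-from-root m 1≤m n)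
    (FlowerKinds.flower-kinded m′ 1≤m′ 0) unseen-to-seen
    (λ { {root} {seen} _ → tt ; {seen} {seen} _ → tt ; {seen} {unseen} _ → tt ; {unseen} {seen} _ → tt ; {unseen} {unseen} _ → tt })
    (λ { {k} {seen} _ _ → ⇝-seen k ; {root} {root} _ () ; {seen} {root} _ () ; {unseen} {root} _ () })
    (λ { {root} _ → refl ; {seen} _ → refl })
    (λ { {root} _ → s≤s z≤n ; {seen} _ → 1≤m′ ; {unseen} _ → 1≤m′ })
    (λ { {root} _ → ≤-refl ; {seen} _ → m′≤m })
flower-validity m m′ 1≤m 1≤m′ (nat n) (nat (suc n′)) m′≤m n′<n =
  kinded-collapse (flower-euclidean m 1≤m (nat n)) (0 , z≤n) (FlowerKinds.flower-kinded m 1≤m n) (flower-kinds-from-root m 1≤m n)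
    (FlowerKinds.flower-kinded m′ 1≤m′ (suc n′)) (λ k → k)
    (λ k⇝l → k⇝l) (λ _ k⇝l → k⇝l) (λ _ → refl)
    (λ { {root} _ → s≤s z≤n ; {seen} _ → 1≤m′ ; {unseen} _ → s≤s z≤n })
    (λ { {root} _ → ≤-refl ; {seen} _ → m′≤m ; {unseen} _ → n′<n })

guard-free : ∀ x y z → FreeIn z (guard x y) → z ≡ x ⊎ z ≡ y
guard-free x y z (ol el) = inj₁ refl
guard-free x y z (ol er) = inj₂ refl
guard-free x y z (or (ng (al _ (ng (ng (ol (ng rl))))))) = inj₁ refl
guard-free x y z (or (ng (al z≢z (ng (ng (ol (ng rr))))))) = ⊥-elim (z≢z refl)
guard-free x y z (or (ng (al z≢z (ng (ng (or (ng rl))))))) = ⊥-elim (z≢z refl)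
guard-free x y z (or (ng (al _ (ng (ng (or (ng rr))))))) = inj₂ refl

τ-free : ∀ x B z → FreeIn z (τ x B) → FreeIn z B ⊎ z ≡ x
τ-free x (Rf _ _) z free = inj₁ free
τ-free x (_ ≐ _) z free = inj₁ free
τ-free x (¬f B) z (ng free) = Sum.map₁ ng (τ-free x B z free)
τ-free x (B ∨f C) z (ol free) = Sum.map₁ ol (τ-free x B z free)
τ-free x (B ∨f C) z (or free) = Sum.map₁ or (τ-free x C z free)
τ-free x (∀f y B) z (al z≢y (ol (ng free))) with guard-free x y z free
... | inj₁ z≡x = inj₂ z≡x
... | inj₂ z≡y = ⊥-elim (z≢y z≡y)
τ-free x (∀f y B) z (al z≢y (or free)) = Sum.map₁ (al z≢y) (τ-free x B z free)

⇔f-free : ∀ A B z → FreeIn z (A ⇔f B) → FreeIn z A ⊎ FreeIn z B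
⇔f-free A B z (ng (ol (ng (ol (ng free))))) = inj₁ free
⇔f-free A B z (ng (ol (ng (or free)))) = inj₂ free
⇔f-free A B z (ng (or (ng (ol (ng free))))) = inj₂ free
⇔f-free A B z (ng (or (ng (or free)))) = inj₁ free

rooted-equivalence-sentence : ∀ A x → Sentence A → Sentence (A ⇔f ∀f x (τ x A))
rooted-equivalence-sentence A x closed z free with ⇔f-free A (∀f x (τ x A)) z free
... | inj₁ free-A = closed z free-A
... | inj₂ (al z≢x free-τ) with τ-free x A z free-τ
...   | inj₁ free-A = closed z free-A
...   | inj₂ z≡x = z≢x z≡x

⇔f-sem : ∀ A B F ρ → ⟦ A ⇔f B ⟧f F ρ ⇔ (⟦ A ⟧f F ρ ⇔ ⟦ B ⟧f F ρ)
⇔f-sem A B F ρ = mk⇔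
  (λ h → mk⇔
    (λ a → ⟦⟧f-stable B F ρ λ ¬b → h λ k → k (inj₁ λ i → i λ { (inj₁ ¬a) → ¬a a ; (inj₂ b) → ¬b b }))
    (λ b → ⟦⟧f-stable A F ρ λ ¬a → h λ k → k (inj₂ λ i → i λ { (inj₁ ¬b) → ¬b b ; (inj₂ a) → ¬a a })))
  (λ A⇔B h → h λ
    { (inj₁ ¬A⇒B) → ¬A⇒B λ k → k (inj₁ λ a → k (inj₂ (to A⇔B a)))
    ; (inj₂ ¬B⇒A) → ¬B⇒A λ k → k (inj₁ λ b → k (inj₂ (from A⇔B b))) })

Defines : Logic → MF → FO → Set₁
Defines L ψ A = (F : Frame) → Fr L F → (F ⊨ₘ ψ → F ⊨f A) × (F ⊨f A → F ⊨ₘ ψ)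

qd≤qdd : ∀ A → qd A ≤ qdd A
qd≤qdd A = m≤m⊔n (qd A) 3

1≤qdd : ∀ A → 1 ≤ qdd A
1≤qdd A = ≤-trans (s≤s z≤n) (m≤n⊔m (qd A) 3)

module _ (L : Logic) (L-euclidean : IsEuclideanLogic L) where

  Fr-generated : ∀ F (F∈Fr : Fr L F) w → Fr L (GeneratedSubframe.F↾w F (Fr-euclidean L L-euclidean F F∈Fr) w)
  Fr-generated F F∈Fr w φ Lφ = GeneratedSubframe.↾-validity F (Fr-euclidean L L-euclidean F F∈Fr) w φ (F∈Fr φ Lφ)

  flower-Fr : ∀ φ → SameLogic L (K5⊕ φ) → ∀ m 1≤m n → Flower m 1≤m n ⊨ₘ φ → Fr L (Flower m 1≤m n)
  flower-Fr φ L≡K5⊕φ m 1≤m n ⊨φ ψ Lψ = K5⊕-sound φ _ (flower-euclidean m 1≤m n) ⊨φ ψ (proj₁ (L≡K5⊕φ ψ) Lψ)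

  -- A defined by ψ holds in F iff it holds in every generated subframe, i.e. iff τ(x, A) holds at every point.
  definable-rooted : ∀ ψ A x → Sentence A → ¬ OccursIn x A → Defines L ψ A →
    ∀ F → Fr L F → F ⊨f (A ⇔f ∀f x (τ x A))
  definable-rooted ψ A x closed x∉ defines F F∈Fr ρ = from (⇔f-sem A (∀f x (τ x A)) F ρ) (mk⇔ forth back)
    where
    euc : Euclidean F
    euc = Fr-euclidean L L-euclidean F F∈Fr
    module ↾ w = GeneratedSubframe F euc w
    τ-at : ∀ w → ↾.F↾w w ⊨f A ⇔ ⟦ τ x A ⟧f F (ρ [ x ↦ w ])
    τ-at w = ↾.τ-generated-sentence w x A closed x∉ (ρ [ x ↦ w ]) (update-same ρ x w)
    forth : ⟦ A ⟧f F ρ → ⟦ ∀f x (τ x A) ⟧f F ρ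
    forth A-holds w = to (τ-at w) (proj₁ (defines _ (Fr-generated F F∈Fr w))
      (↾.↾-validity w ψ (proj₂ (defines F F∈Fr) λ ρ′ → sentence-env-irrelevant A F ρ ρ′ closed A-holds)))
    back : ⟦ ∀f x (τ x A) ⟧f F ρ → ⟦ A ⟧f F ρ
    back τ-holds = proj₁ (defines F F∈Fr) (λ V w → ↾.↾-truth-at-root w ψ V
      (proj₂ (defines _ (Fr-generated F F∈Fr w)) (from (τ-at w) (τ-holds w)))) ρ

  definable-flower-downward : ∀ φ → SameLogic L (K5⊕ φ) → ∀ ψ A → Defines L ψ A →
    ∀ m m′ (1≤m : 1 ≤ m) (1≤m′ : 1 ≤ m′) n n′ → Flower m 1≤m n ⊨ₘ φ → m′ ≤ m → n′ ≤⁻ n →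
    Flower m 1≤m n ⊨f A → Flower m′ 1≤m′ n′ ⊨f A
  definable-flower-downward φ L≡K5⊕φ ψ A defines m m′ 1≤m 1≤m′ n n′ ⊨φ m′≤m n′≤n A-holds =
    proj₁ (defines _ smaller∈Fr) (flower-validity m m′ 1≤m 1≤m′ n n′ m′≤m n′≤n ψ (proj₂ (defines _ flower∈Fr) A-holds))
    where
    flower∈Fr : Fr L (Flower m 1≤m n)
    flower∈Fr = flower-Fr φ L≡K5⊕φ m 1≤m n ⊨φ
    smaller∈Fr : Fr L (Flower m′ 1≤m′ n′)
    smaller∈Fr χ Lχ = flower-validity m m′ 1≤m 1≤m′ n n′ m′≤m n′≤n χ (flower∈Fr χ Lχ)

  definable⇒Cond2 : ∀ φ → SameLogic L (K5⊕ φ) → ∀ k A x → Sentence A → ¬ OccursIn x A →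
    ModallyDefinable (Fr L) A → Cond2 L φ k A x
  definable⇒Cond2 φ L≡K5⊕φ k A x closed x∉ definable =
    ( (rooted-equivalence-sentence A x closed
      , λ F F∈Fr ρ → ¬¬-rec (⟦⟧f-stable (A ⇔f ∀f x (τ x A)) F ρ) definable
          λ { (ψ , defines) → definable-rooted ψ A x closed x∉ defines F F∈Fr ρ })
    , λ m m′ 1≤m 1≤m′ n n′ ⊨φ _ m′≤m n′≤n A-holds → ¬¬-rec (⊨f-stable _ A) definable
          λ { (ψ , defines) → definable-flower-downward φ L≡K5⊕φ ψ A defines m m′ 1≤m 1≤m′ n n′ ⊨φ m′≤m n′≤n A-holds })

  module _ (φ : MF) (L≡K5⊕φ : SameLogic L (K5⊕ φ)) (k : ℕ) (k-bound : BoundK L k)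
           (A : FO) (closed : Sentence A) (x : ℕ) (x∉ : ¬ OccursIn x A) (cond : Cond2 L φ k A x) where

    private
      q : ℕ
      q = qdd A

      Lφ : L φ
      Lφ = proj₂ (L≡K5⊕φ φ) axφ

      rooted : ∀ F → Fr L F → ∀ ρ → ⟦ A ⟧f F ρ ⇔ ⟦ ∀f x (τ x A) ⟧f F ρ
      rooted F F∈Fr ρ = to (⇔f-sem A (∀f x (τ x A)) F ρ) (proj₂ (proj₁ cond) F F∈Fr ρ)

      cluster-∈Π : ∀ a → suc a ≤ q → InΠ k A (suc a) minus1
      cluster-∈Π a a<q = (λ _ ()) , (λ _ → tt) , (λ _ → a<q)

      flower-∈Π : ∀ a n → suc a ≤ q → n ≤ q → Fr L (model (flower a n)) → InΠ k A (suc a) (nat n)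
      flower-∈Π a n a<q n≤q ∈Fr = (λ 2≤m 2≤n → k-bound (suc a) (s≤s z≤n) (nat n) ∈Fr (2≤m , 2≤n)) , (λ _ → n≤q) , (λ _ → a<q)

      models-downward : ∀ t′ t → t′ ≼ t → Bounded q t → Fr L (model t) → model t ⊨f A → model t′ ⊨f A
      models-downward deadEnd deadEnd _ _ _ A-holds = A-holds
      models-downward (cluster a′) (cluster a) a′≤a a<q ∈Fr =
        proj₂ cond (suc a) (suc a′) (s≤s z≤n) (s≤s z≤n) minus1 minus1 (∈Fr φ Lφ) (cluster-∈Π a a<q) (s≤s a′≤a) tt
      models-downward (cluster a′) (flower a n) a′≤a (a<q , n≤q) ∈Fr =
        proj₂ cond (suc a) (suc a′) (s≤s z≤n) (s≤s z≤n) (nat n) minus1 (∈Fr φ Lφ) (flower-∈Π a n a<q n≤q ∈Fr) (s≤s a′≤a) tt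
      models-downward (flower a′ n′) (flower a n) (a′≤a , n′≤n) (a<q , n≤q) ∈Fr =
        proj₂ cond (suc a) (suc a′) (s≤s z≤n) (s≤s z≤n) (nat n) (nat n′) (∈Fr φ Lφ) (flower-∈Π a n a<q n≤q ∈Fr) (s≤s a′≤a) n′≤n
      models-downward deadEnd (cluster _) () _ _ _
      models-downward deadEnd (flower _ _) () _ _ _
      models-downward (cluster _) deadEnd () _ _ _
      models-downward (flower _ _) deadEnd () _ _ _
      models-downward (flower _ _) (cluster _) () _ _ _

    Bad : Shape → Set
    Bad t = Bounded q t × ¬ (model t ⊨f A)

    module _ (F : Frame) (F∈Fr : Fr L F) where
      private
        euc : Euclidean F
        euc = Fr-euclidean L L-euclidean F F∈Fr

      shape-Fr : ∀ {w} (S : ShapeAt F euc w q) → Fr L (model (ShapeAt.shape S))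
      shape-Fr S ψ Lψ = ShapeFacts.shape-collapse (1≤qdd A) S ψ (F∈Fr ψ Lψ)

      τ⇔shape : ∀ {w} (S : ShapeAt F euc w q) ρ → ⟦ τ x A ⟧f F (ρ [ x ↦ w ]) ⇔ model (ShapeAt.shape S) ⊨f A
      τ⇔shape {w} S ρ = ShapeFacts.τ-shape (1≤qdd A) S x A closed x∉ (qd≤qdd A) (ρ [ x ↦ w ]) (update-same ρ x w)

      bad-χ-valid : F ⊨f A → ∀ t → Bad t → F ⊨ₘ χ t
      bad-χ-valid A-holds t (bounded , ¬A) = ⊨ₘ-stable F (χ t) λ ¬valid →
        χ-refuted-atLeast F t ¬valid λ { (w , atLeast) → shape-exists F euc w q (1≤qdd A) λ S →
          ¬A (models-downward t (ShapeAt.shape S) (ShapeFacts.atLeast-≼ (1≤qdd A) S t atLeast bounded)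
                (ShapeAt.bounded S) (shape-Fr S) (to (τ⇔shape S ρ) (to (rooted F F∈Fr ρ) (A-holds ρ) w))) }
        where
        ρ : ℕ → W F
        ρ _ = pt F

      χ-valid-A : ∀ bs → (∀ t → Bad t → t ∈ bs) → F ⊨ₘ ⋀ₗ (map χ bs) → F ⊨f A
      χ-valid-A bs bad∈bs valid ρ = from (rooted F F∈Fr ρ) λ w →
        ¬¬-rec (⟦⟧f-stable (τ x A) F _) (shape-exists F euc w q (1≤qdd A)) λ S →
        ¬¬-rec (⟦⟧f-stable (τ x A) F _) (¬¬-excluded-middle {A = model (ShapeAt.shape S) ⊨f A}) λ
          { (yes shape⊨A) → from (τ⇔shape S ρ) shape⊨A
          ; (no shape⊭A) → ⊥-elim (atLeast-refutes-χ F w _ (ShapeFacts.shape-atLeast (1≤qdd A) S)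
              (to (⋀ₗ-valid F (map χ bs)) valid (∈-map⁺ χ (bad∈bs _ (ShapeAt.bounded S , shape⊭A))))) }

    Cond2⇒definable : ModallyDefinable (Fr L) A
    Cond2⇒definable = ¬¬-filter Bad (shapes q) >>= λ { (bs , spec) →
      let bad∈bs : ∀ t → Bad t → t ∈ bs
          bad∈bs t bad = from (spec t) (bounded-∈-shapes q t (proj₁ bad) , bad)
          bs-bad : ∀ {ψ} → ψ ∈ map χ bs → Σ[ t ∈ Shape ] Bad t × ψ ≡ χ t
          bs-bad ψ∈ = let (t , t∈ , ψ≡) = ∈-map⁻ χ ψ∈ in t , proj₂ (to (spec t) t∈) , ψ≡
      in return (⋀ₗ (map χ bs) , λ F F∈Fr →
           χ-valid-A F F∈Fr bs bad∈bs ,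
           λ A-holds → from (⋀ₗ-valid F (map χ bs)) λ ψ∈ → let (t , bad , ψ≡) = bs-bad ψ∈ in
             subst (F ⊨ₘ_) (sym ψ≡) (bad-χ-valid F F∈Fr A-holds t bad)) }

-- Finiteness of S_L only guarantees that k exists; the proof uses no more than that k bounds m + n there.
lemma55 : (L : Logic) → IsEuclideanLogic L → FiniteBigS L →
    (φ : MF) → SameLogic L (K5⊕ φ) →
    (k : ℕ) → IsLeastK L k →
    (A : FO) → Sentence A → (x : ℕ) → ¬ OccursIn x A →
      (ModallyDefinable (Fr L) A → Cond2 L φ k A x)
      × (Cond2 L φ k A x → ModallyDefinable (Fr L) A)
lemma55 L L-euclidean _ φ L≡K5⊕φ k (_ , k-bound , _) A closed x x∉ =
  definable⇒Cond2 L L-euclidean φ L≡K5⊕φ k A x closed x∉ ,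
  Cond2⇒definable L L-euclidean φ L≡K5⊕φ k k-bound A closed x x∉
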